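{- For $n\geqslant 1$ let $V_n(q,x,y)=\sum_{\pi\in\mathfrak{S}_n}q^{\operatorname{cval}(\pi)}x^{\operatorname{cyc}(\pi)}y^{\operatorname{fix}(\pi)}$. Then for $n\geqslant 1$, \begin{align*} V_{n+1}(q,x,y)&=(nq+xy)V_n(q,x,y)+2q(1-q)\frac{\partial V_n(q,x,y)}{\partial q}+2x(1-q)\frac{\partial V_n(q,x,y)}{\partial x}\\ &\quad+(1-2y+qy)\frac{\partial V_n(q,x,y)}{\partial y}. \end{align*}
   Context: $\mathfrak{S}_n$ is the set of permutations of $[n]=\{1,\dots,n\}$. Every permutation is written in standard cycle decomposition: each cycle is written with its smallest entry first, and cycles are listed in increasing order of their smallest entries. For a cycle $(c_1,\dots,c_\ell)$ so written, an entry $c_m$ with $2\leqslant m\leqslant \ell-1$ is a cyclic valley if $c_{m-1}>c_m<c_{m+1}$. $\operatorname{cval}(\pi)$ is the total number of cyclic valleys over all cycles of $\pi$, $\operatorname{cyc}(\pi)$ the number of cycles, and $\operatorname{fix}(\pi)$ the number of fixed points of $\pi$. -}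

module Defs where

open import Data.Bool using (Bool; true; false; not; _∧_; if_then_else_)
open import Data.Nat using (ℕ; zero; suc; _+_; _*_; _∸_; _≡ᵇ_; _≤ᵇ_; _<ᵇ_)
open import Data.Integer as ℤ using (ℤ; +_)
open import Data.Fin using (Fin; toℕ)
open import Data.Vec using (Vec; []; _∷_; toList)
open import Data.List using (List; []; _∷_; [_]; map; concatMap; allFin; upTo; length; filterᵇ; any; all; sum)

-- Permutations of [n], relabelled as {0,…,n-1} (order preserving, so all
-- statistics are unchanged), in one-line notation: a vector of length n
-- with entries in Fin n, all distinct.

allVecs : (n m : ℕ) → List (Vec (Fin m) n)
allVecs zero    m = [ [] ]
allVecs (suc n) m = concatMap (λ v → map (λ a → a ∷ v) (allFin m)) (allVecs n m)

distinctᵇ : List ℕ → Bool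
distinctᵇ []       = true
distinctᵇ (x ∷ xs) = not (any (x ≡ᵇ_) xs) ∧ distinctᵇ xs

Perm : ℕ → Set
Perm n = Vec (Fin n) n

oneLine : ∀ {n} → Perm n → List ℕ
oneLine v = map toℕ (toList v)

perms : (n : ℕ) → List (Perm n)
perms n = filterᵇ (λ v → distinctᵇ (oneLine v)) (allVecs n n)

-- the permutation as a map on ℕ (identity outside {0,…,n-1})
lookupD : List ℕ → ℕ → ℕ → ℕ
lookupD []       d _       = d
lookupD (x ∷ xs) d zero    = x
lookupD (x ∷ xs) d (suc i) = lookupD xs d i

app : ∀ {n} → Perm n → ℕ → ℕ
app π i = lookupD (oneLine π) i i

orbitGo : (ℕ → ℕ) → ℕ → ℕ → ℕ → List ℕ
orbitGo f s zero    c = []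
orbitGo f s (suc k) c = if c ≡ᵇ s then [] else c ∷ orbitGo f s k (f c)

cycleOf : ∀ {n} → Perm n → ℕ → List ℕ
cycleOf {n} π i = i ∷ orbitGo (app π) i n (app π i)

isCycleMin : ∀ {n} → Perm n → ℕ → Bool
isCycleMin π i = all (i ≤ᵇ_) (cycleOf π i)

-- standard cycle decomposition: each cycle starts with its minimum,
-- cycles listed by increasing minima
cycles : ∀ {n} → Perm n → List (List ℕ)
cycles {n} π = map (cycleOf π) (filterᵇ (isCycleMin π) (upTo n))

cvalCycle : List ℕ → ℕ
cvalCycle (a ∷ b ∷ c ∷ rest) =
  (if (b <ᵇ a) ∧ (b <ᵇ c) then 1 else 0) + cvalCycle (b ∷ c ∷ rest)
cvalCycle _ = 0

cval : ∀ {n} → Perm n → ℕ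
cval π = sum (map cvalCycle (cycles π))

cyc : ∀ {n} → Perm n → ℕ
cyc π = length (cycles π)

fix : ∀ {n} → Perm n → ℕ
fix {n} π = length (filterᵇ (λ i → app π i ≡ᵇ i) (upTo n))

-- Formal polynomials in q, x, y with integer coefficients, represented by
-- their coefficient function: P i j k = coefficient of q^i x^j y^k.

Poly3 : Set
Poly3 = ℕ → ℕ → ℕ → ℤ

_⊕_ : Poly3 → Poly3 → Poly3
(P ⊕ Q) i j k = P i j k ℤ.+ Q i j k

infixl 6 _⊕_

_·_ : ℤ → Poly3 → Poly3
(c · P) i j k = c ℤ.* P i j k

infixr 7 _·_

-- multiplication by the monomial q^a x^b y^c
shiftDown : ℕ → ℕ → ℤ → (ℕ → ℤ) → ℤ
shiftDown zero    i       z f = f i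
shiftDown (suc a) zero    z f = z
shiftDown (suc a) (suc i) z f = shiftDown a i z f

mono : ℕ → ℕ → ℕ → Poly3 → Poly3
mono a b c P i j k =
  shiftDown a i (+ 0) (λ i′ → shiftDown b j (+ 0) (λ j′ → shiftDown c k (+ 0) (λ k′ → P i′ j′ k′)))

∂q ∂x ∂y : Poly3 → Poly3
∂q P i j k = + (suc i) ℤ.* P (suc i) j k
∂x P i j k = + (suc j) ℤ.* P i (suc j) k
∂y P i j k = + (suc k) ℤ.* P i j (suc k)

V : ℕ → Poly3
V n i j k = + length (filterᵇ (λ π → (cval π ≡ᵇ i) ∧ (cyc π ≡ᵇ j) ∧ (fix π ≡ᵇ k)) (perms n))

-- right-hand side:
-- (nq + xy) V + 2q(1-q) ∂V/∂q + 2x(1-q) ∂V/∂x + (1 - 2y + qy) ∂V/∂y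
recRHS : ℕ → Poly3 → Poly3
recRHS n P =
    (+ n) · mono 1 0 0 P ⊕ mono 0 1 1 P
  ⊕ (+ 2) · mono 1 0 0 (∂q P) ⊕ (ℤ.- + 2) · mono 2 0 0 (∂q P)
  ⊕ (+ 2) · mono 0 1 0 (∂x P) ⊕ (ℤ.- + 2) · mono 1 1 0 (∂x P)
  ⊕ ∂y P ⊕ (ℤ.- + 2) · mono 0 0 1 (∂y P) ⊕ mono 1 0 1 (∂y P)

-- A permutation τ of {0,…,n} arises exactly once from a permutation σ of {0,…,n-1} by inserting n right after
-- some c ≤ n in its cycle.  Inserting at c = n adds a fixed point and a cycle; at a fixed point c it removes a
-- fixed point; at a moved point c it keeps cyc and fix and raises cval by valleyGain c ∈ {0,1}.  Counting valleys
-- cyclically along the orbits, valleys(σ) = #{y : σ y < y, σ y < σ² y} satisfies cval + cyc = valleys + fix, and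
-- sorting the moved points by the shape of (y, σ y, σ² y) gives n = fix + Σ_c valleyGain c + 2 valleys.  Hence the
-- n + 1 insertions into a σ with (cval, cyc, fix) = (a, b, d) contribute
--   q^a x^(b+1) y^(d+1) + d q^a x^b y^(d-1) + (n - 2a - 2b + d) q^(a+1) x^b y^d + 2(a + b - d) q^a x^b y^d,
-- which is exactly the differential operator of the recurrence applied to q^a x^b y^d; the operator is linear.

module Submission where

open import Defs

open import Algebra.Bundles using (AbelianGroup)
import Algebra.Properties.CommutativeSemigroup as CommSemigroupProperties
open import Data.Bool using (Bool; true; false; not; _∧_; if_then_else_)
open import Data.Bool.ListAction using (all; any)
open import Data.Bool.Properties using (T-≡; ∧-zeroʳ; ∧-identityʳ)
open import Data.Empty using (⊥; ⊥-elim)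
open import Data.Fin using (Fin; toℕ; fromℕ<; punchOut)
open import Data.Fin.Properties
  using (pigeonhole; toℕ-fromℕ<; fromℕ<-toℕ; toℕ-injective; toℕ<n; punchOut-injective; injective⇒≤; any?)
  renaming (_≟_ to _≟ᶠ_)
open import Data.Integer as ℤ using (ℤ)
import Data.Integer.Properties as ℤ
import Data.Integer.Tactic.RingSolver as ℤ-Solver
open import Data.List using (List; []; _∷_; [_]; _++_; map; concatMap; filterᵇ; upTo; applyUpTo; length; allFin)
import Data.List as List
open import Data.List.Membership.Propositional using (_∈_; find; lose)
open import Data.List.Membership.Propositional.Properties
  using (∈-filter⁻; ∈-filter⁺; ∈-concatMap⁻; ∈-concatMap⁺; ∈-map⁺; ∈-map⁻; ∈-applyUpTo⁺; ∈-applyUpTo⁻; ∈-upTo⁺; ∈-upTo⁻; ∈-allFin)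
open import Data.List.Membership.Propositional.Properties.WithK using (unique∧set⇒bag)
open import Data.List.Properties using (length-map; map-∘; map-cong; map-++; upTo-∷ʳ; map-tabulate; map-upTo)
open import Data.List.Relation.Binary.BagAndSetEquality using (∼bag⇒↭)
open import Data.List.Relation.Binary.Permutation.Propositional using (_↭_)
import Data.List.Relation.Binary.Permutation.Propositional.Properties as Perm
open import Data.List.Relation.Unary.All using (All; []; _∷_)
import Data.List.Relation.Unary.All as All
open import Data.List.Relation.Unary.AllPairs using ([]; _∷_)
open import Data.List.Relation.Unary.Any using (here; there)
open import Data.List.Relation.Unary.Unique.Propositional using (Unique)
import Data.List.Relation.Unary.Unique.Propositional.Properties as Unique
open import Data.Nat
open import Data.Nat.GeneralisedArithmetic using (iterate)
open import Data.Nat.ListAction using (sum)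
open import Data.Nat.ListAction.Properties using (sum-++; sum-↭)
open import Data.Nat.Properties
open import Data.Nat.Tactic.RingSolver using (solve-∀)
open import Data.Product using (∃; _×_; _,_; proj₁; proj₂)
open import Data.Sum using (_⊎_; inj₁; inj₂)
open import Data.Vec using (Vec; []; _∷_; toList; lookup; tabulate)
import Data.Vec.Properties as Vec
open import Function using (_∘_; Equivalence)
open import Function.Bundles using (mk⇔)
open import Relation.Binary.Definitions using (tri<; tri≈; tri>)
open import Relation.Binary.PropositionalEquality hiding ([_])
open import Relation.Nullary using (¬_; Dec; yes; no)
open import Relation.Nullary.Decidable using (T?)

open import Algebra.Properties.Group (AbelianGroup.group ℤ.+-0-abelianGroup) using (identityʳ-unique)
open CommSemigroupProperties +-commutativeSemigroup using (xy∙z≈xz∙y) renaming (interchange to +-interchange)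

private
  variable
    A B : Set

𝟙 : Bool → ℕ
𝟙 b = if b then 1 else 0

≡⇒≡ᵇ≡true : ∀ {m n} → m ≡ n → (m ≡ᵇ n) ≡ true
≡⇒≡ᵇ≡true {m} {n} e = Equivalence.to T-≡ (≡⇒≡ᵇ m n e)

≢⇒≡ᵇ≡false : ∀ {m n} → m ≢ n → (m ≡ᵇ n) ≡ false
≢⇒≡ᵇ≡false {m} {n} ne with m ≡ᵇ n in eq
... | true  = ⊥-elim (ne (≡ᵇ⇒≡ m n (Equivalence.from T-≡ eq)))
... | false = refl

≡ᵇ≡true⇒≡ : ∀ {m n} → (m ≡ᵇ n) ≡ true → m ≡ n
≡ᵇ≡true⇒≡ {m} {n} e = ≡ᵇ⇒≡ m n (Equivalence.from T-≡ e)

≡ᵇ≡false⇒≢ : ∀ {m n} → (m ≡ᵇ n) ≡ false → m ≢ n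
≡ᵇ≡false⇒≢ {m} e refl with () ← trans (sym (≡⇒≡ᵇ≡true {m} refl)) e

<⇒<ᵇ≡true : ∀ {m n} → m < n → (m <ᵇ n) ≡ true
<⇒<ᵇ≡true lt = Equivalence.to T-≡ (<⇒<ᵇ lt)

≮⇒<ᵇ≡false : ∀ {m n} → ¬ m < n → (m <ᵇ n) ≡ false
≮⇒<ᵇ≡false {m} {n} nlt with m <ᵇ n in eq
... | true  = ⊥-elim (nlt (<ᵇ⇒< m n (Equivalence.from T-≡ eq)))
... | false = refl

<ᵇ≡true⇒< : ∀ {m n} → (m <ᵇ n) ≡ true → m < n
<ᵇ≡true⇒< {m} {n} e = <ᵇ⇒< m n (Equivalence.from T-≡ e)

<ᵇ-irrefl : ∀ n → (n <ᵇ n) ≡ false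
<ᵇ-irrefl n = ≮⇒<ᵇ≡false (n≮n n)

<ᵇ-swap : ∀ {m n} → m ≢ n → (n <ᵇ m) ≡ not (m <ᵇ n)
<ᵇ-swap {m} {n} ne with <-cmp m n
... | tri< lt _ _ = trans (≮⇒<ᵇ≡false (<⇒≯ lt)) (cong not (sym (<⇒<ᵇ≡true lt)))
... | tri≈ _ e _  = ⊥-elim (ne e)
... | tri> _ _ gt = trans (<⇒<ᵇ≡true gt) (cong not (sym (≮⇒<ᵇ≡false (<⇒≯ gt))))

≤⇒≤ᵇ≡true : ∀ {m n} → m ≤ n → (m ≤ᵇ n) ≡ true
≤⇒≤ᵇ≡true le = Equivalence.to T-≡ (≤⇒≤ᵇ le)

≤ᵇ≡true⇒≤ : ∀ {m n} → (m ≤ᵇ n) ≡ true → m ≤ n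
≤ᵇ≡true⇒≤ {m} {n} e = ≤ᵇ⇒≤ m n (Equivalence.from T-≡ e)

∑ : ℕ → (ℕ → ℕ) → ℕ
∑ zero    g = 0
∑ (suc n) g = ∑ n g + g n

∑-cong : ∀ n {g h : ℕ → ℕ} → (∀ y → y < n → g y ≡ h y) → ∑ n g ≡ ∑ n h
∑-cong zero    e = refl
∑-cong (suc n) e = cong₂ _+_ (∑-cong n (λ y y<n → e y (m<n⇒m<1+n y<n))) (e n ≤-refl)

∑-+ : ∀ n (g h : ℕ → ℕ) → ∑ n (λ y → g y + h y) ≡ ∑ n g + ∑ n h
∑-+ zero    g h = refl
∑-+ (suc n) g h = trans (cong (_+ (g n + h n)) (∑-+ n g h)) (+-interchange (∑ n g) (∑ n h) (g n) (h n))

∑-*ʳ : ∀ n (g : ℕ → ℕ) c → ∑ n (λ y → g y * c) ≡ ∑ n g * c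
∑-*ʳ zero    g c = refl
∑-*ʳ (suc n) g c = trans (cong (_+ g n * c) (∑-*ʳ n g c)) (sym (*-distribʳ-+ c (∑ n g) (g n)))

∑-const-1 : ∀ n → ∑ n (λ _ → 1) ≡ n
∑-const-1 zero    = refl
∑-const-1 (suc n) = trans (cong (_+ 1) (∑-const-1 n)) (+-comm n 1)

∑-update : ∀ n {c} → c < n → (g h : ℕ → ℕ) → (∀ y → y < n → y ≢ c → g y ≡ h y) → ∑ n g + h c ≡ ∑ n h + g c
∑-update (suc m) {c} c<1+m g h agree with m ≟ c
... | yes refl = begin
    ∑ m g + g m + h m  ≡⟨ cong (λ z → z + g m + h m) (∑-cong m (λ y y<m → agree y (m<n⇒m<1+n y<m) (<⇒≢ y<m))) ⟩
    ∑ m h + g m + h m  ≡⟨ xy∙z≈xz∙y (∑ m h) (g m) (h m) ⟩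
    ∑ m h + h m + g m  ∎
  where open ≡-Reasoning
... | no m≢c = begin
    ∑ m g + g m + h c  ≡⟨ xy∙z≈xz∙y (∑ m g) (g m) (h c) ⟩
    ∑ m g + h c + g m  ≡⟨ cong₂ _+_ (∑-update m (≤∧≢⇒< (≤-pred c<1+m) (m≢c ∘ sym)) g h (λ y y<m → agree y (m<n⇒m<1+n y<m)))
                                    (agree m ≤-refl m≢c) ⟩
    ∑ m h + g c + h m  ≡⟨ xy∙z≈xz∙y (∑ m h) (g c) (h m) ⟩
    ∑ m h + h m + g c  ∎
  where open ≡-Reasoning

∑-update₂ : ∀ n {c p} → c < n → p < n → c ≢ p → (g h : ℕ → ℕ) → (∀ y → y < n → y ≢ c → y ≢ p → g y ≡ h y) →
            ∑ n g + (h c + h p) ≡ ∑ n h + (g c + g p)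
∑-update₂ n {c} {p} c<n p<n c≢p g h agree = begin
    ∑ n g + (h c + h p)   ≡⟨ sym (+-assoc (∑ n g) (h c) (h p)) ⟩
    ∑ n g + h c + h p     ≡⟨ cong (λ z → ∑ n g + z + h p) (sym k-c) ⟩
    ∑ n g + k c + h p     ≡⟨ cong (_+ h p) (∑-update n c<n g k g≗k) ⟩
    ∑ n k + g c + h p     ≡⟨ xy∙z≈xz∙y (∑ n k) (g c) (h p) ⟩
    ∑ n k + h p + g c     ≡⟨ cong (_+ g c) (∑-update n p<n k h k≗h) ⟩
    ∑ n h + k p + g c     ≡⟨ cong (λ z → ∑ n h + z + g c) k-p ⟩
    ∑ n h + g p + g c     ≡⟨ xy∙z≈xz∙y (∑ n h) (g p) (g c) ⟩
    ∑ n h + g c + g p     ≡⟨ +-assoc (∑ n h) (g c) (g p) ⟩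
    ∑ n h + (g c + g p)   ∎
  where
  open ≡-Reasoning
  k : ℕ → ℕ
  k y = if y ≡ᵇ c then h c else g y
  k-c : k c ≡ h c
  k-c = cong (if_then h c else g c) (≡⇒≡ᵇ≡true {c} refl)
  k-p : k p ≡ g p
  k-p = cong (if_then h c else g p) (≢⇒≡ᵇ≡false (c≢p ∘ sym))
  g≗k : ∀ y → y < n → y ≢ c → g y ≡ k y
  g≗k y _ y≢c = cong (if_then h c else g y) (sym (≢⇒≡ᵇ≡false y≢c))
  k≗h : ∀ y → y < n → y ≢ p → k y ≡ h y
  k≗h y y<n y≢p with y ≟ c
  ... | yes refl = k-c
  ... | no  y≢c  = trans (sym (g≗k y y<n y≢c)) (agree y y<n y≢c y≢p)

sum-map-upTo : ∀ (g : ℕ → ℕ) n → sum (map g (upTo n)) ≡ ∑ n g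
sum-map-upTo g zero    = refl
sum-map-upTo g (suc n) = begin
    sum (map g (upTo (suc n)))          ≡⟨ cong (sum ∘ map g) (sym (upTo-∷ʳ n)) ⟩
    sum (map g (upTo n ++ [ n ]))       ≡⟨ cong sum (map-++ g (upTo n) [ n ]) ⟩
    sum (map g (upTo n) ++ [ g n ])     ≡⟨ sum-++ (map g (upTo n)) [ g n ] ⟩
    sum (map g (upTo n)) + (g n + 0)    ≡⟨ cong₂ _+_ (sum-map-upTo g n) (+-identityʳ (g n)) ⟩
    ∑ n g + g n                         ∎
  where open ≡-Reasoning

length-filterᵇ : ∀ (p : A → Bool) xs → length (filterᵇ p xs) ≡ sum (map (𝟙 ∘ p) xs)
length-filterᵇ p []       = refl
length-filterᵇ p (x ∷ xs) with p x
... | true  = cong suc (length-filterᵇ p xs)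
... | false = length-filterᵇ p xs

sum-map-filterᵇ : ∀ (p : A → Bool) (g : A → ℕ) xs →
                  sum (map g (filterᵇ p xs)) ≡ sum (map (λ x → if p x then g x else 0) xs)
sum-map-filterᵇ p g []       = refl
sum-map-filterᵇ p g (x ∷ xs) with p x
... | true  = cong (g x +_) (sum-map-filterᵇ p g xs)
... | false = sum-map-filterᵇ p g xs

count-upTo : ∀ (p : ℕ → Bool) n → length (filterᵇ p (upTo n)) ≡ ∑ n (𝟙 ∘ p)
count-upTo p n = trans (length-filterᵇ p (upTo n)) (sum-map-upTo (𝟙 ∘ p) n)

sum-map-cong : ∀ (g h : A → ℕ) xs → (∀ x → x ∈ xs → g x ≡ h x) → sum (map g xs) ≡ sum (map h xs)
sum-map-cong g h []       e = refl
sum-map-cong g h (x ∷ xs) e = cong₂ _+_ (e x (here refl)) (sum-map-cong g h xs (λ y y∈ → e y (there y∈)))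

sum-map-+ : ∀ (g h : A → ℕ) xs → sum (map (λ x → g x + h x) xs) ≡ sum (map g xs) + sum (map h xs)
sum-map-+ g h []       = refl
sum-map-+ g h (x ∷ xs) = trans (cong (g x + h x +_) (sum-map-+ g h xs))
                               (+-interchange (g x) (h x) (sum (map g xs)) (sum (map h xs)))

sum-map-concatMap : ∀ (f : B → ℕ) (g : A → List B) xs →
                    sum (map f (concatMap g xs)) ≡ sum (map (λ x → sum (map f (g x))) xs)
sum-map-concatMap f g []       = refl
sum-map-concatMap f g (x ∷ xs) = begin
    sum (map f (g x ++ concatMap g xs))               ≡⟨ cong sum (map-++ f (g x) (concatMap g xs)) ⟩
    sum (map f (g x) ++ map f (concatMap g xs))       ≡⟨ sum-++ (map f (g x)) _ ⟩
    sum (map f (g x)) + sum (map f (concatMap g xs))  ≡⟨ cong (sum (map f (g x)) +_) (sum-map-concatMap f g xs) ⟩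
    sum (map f (g x)) + sum (map (λ x → sum (map f (g x))) xs) ∎
  where open ≡-Reasoning

∈-filterᵇ⁻ : ∀ (p : A → Bool) {x xs} → x ∈ filterᵇ p xs → x ∈ xs × p x ≡ true
∈-filterᵇ⁻ p x∈ = let x∈xs , px = ∈-filter⁻ (T? ∘ p) x∈ in x∈xs , Equivalence.to T-≡ px

∈-filterᵇ⁺ : ∀ (p : A → Bool) {x xs} → x ∈ xs → p x ≡ true → x ∈ filterᵇ p xs
∈-filterᵇ⁺ p x∈ px = ∈-filter⁺ (T? ∘ p) x∈ (Equivalence.from T-≡ px)

unique-filterᵇ : ∀ (p : A → Bool) {xs} → Unique xs → Unique (filterᵇ p xs)
unique-filterᵇ p = Unique.filter⁺ (T? ∘ p)

∈-concatMap-find : ∀ (g : A → List B) {y} xs → y ∈ concatMap g xs → ∃ λ x → x ∈ xs × y ∈ g x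
∈-concatMap-find g xs y∈ = find (∈-concatMap⁻ g {xs = xs} y∈)

∈-concatMap-lose : ∀ (g : A → List B) {x y xs} → x ∈ xs → y ∈ g x → y ∈ concatMap g xs
∈-concatMap-lose g x∈ y∈ = ∈-concatMap⁺ g (lose x∈ y∈)

unique-concatMap : ∀ (g : A → List B) {xs} → Unique xs →
  (∀ {x} → x ∈ xs → Unique (g x)) →
  (∀ {x x′ y} → x ∈ xs → x′ ∈ xs → y ∈ g x → y ∈ g x′ → x ≡ x′) →
  Unique (concatMap g xs)
unique-concatMap g {[]}     []         uniq disj = []
unique-concatMap g {x ∷ xs} (x∉ ∷ xs!) uniq disj =
  Unique.++⁺ (uniq (here refl)) (unique-concatMap g xs! (uniq ∘ there) (λ x∈ x′∈ → disj (there x∈) (there x′∈))) separate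
  where
  separate : ∀ {y} → y ∈ g x × y ∈ concatMap g xs → ⊥
  separate (y∈gx , y∈rest) with x′ , x′∈xs , y∈gx′ ← ∈-concatMap-find g xs y∈rest =
    All.lookup x∉ x′∈xs (disj (here refl) (there x′∈xs) y∈gx y∈gx′)

unique-↭ : ∀ {xs ys : List A} → Unique xs → Unique ys →
           (∀ {x} → x ∈ xs → x ∈ ys) → (∀ {x} → x ∈ ys → x ∈ xs) → xs ↭ ys
unique-↭ xs! ys! to from = ∼bag⇒↭ (unique∧set⇒bag xs! ys! (mk⇔ to from))

record IsPerm (n : ℕ) (f : ℕ → ℕ) : Set where
  field
    bounded         : ∀ {y} → y < n → f y < n
    identity-beyond : ∀ {y} → n ≤ y → f y ≡ y
    injective       : ∀ {y z} → y < n → z < n → f y ≡ f z → y ≡ z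
    surjective      : ∀ {x} → x < n → ∃ λ y → y < n × f y ≡ x

-- cval π, cyc π and fix π unfold to cvalF n (app π), cycF n (app π) and fixF n (app π), so that the
-- insertions can be performed on functions.
cycleF : ℕ → (ℕ → ℕ) → ℕ → List ℕ
cycleF n f i = i ∷ orbitGo f i n (f i)

isCycleMinF : ℕ → (ℕ → ℕ) → ℕ → Bool
isCycleMinF n f i = all (i ≤ᵇ_) (cycleF n f i)

cycleMins : ℕ → (ℕ → ℕ) → List ℕ
cycleMins n f = filterᵇ (isCycleMinF n f) (upTo n)

cvalF cycF fixF : ℕ → (ℕ → ℕ) → ℕ
cvalF n f = sum (map cvalCycle (map (cycleF n f) (cycleMins n f)))
cycF  n f = length (map (cycleF n f) (cycleMins n f))
fixF  n f = length (filterᵇ (λ i → f i ≡ᵇ i) (upTo n))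

iterate-suc : ∀ (f : ℕ → ℕ) x t → iterate f x (suc t) ≡ f (iterate f x t)
iterate-suc f x zero    = refl
iterate-suc f x (suc t) = iterate-suc f (f x) t

iterate-+ : ∀ (f : ℕ → ℕ) x s t → iterate f x (s + t) ≡ iterate f (iterate f x s) t
iterate-+ f x zero    t = refl
iterate-+ f x (suc s) t = iterate-+ f (f x) s t

iterate-fixed : ∀ (f : ℕ → ℕ) {y} → f y ≡ y → ∀ t → iterate f y t ≡ y
iterate-fixed f e zero    = refl
iterate-fixed f e (suc t) = trans (cong (λ z → iterate f z t) e) (iterate-fixed f e t)

IsOrbitMin : (ℕ → ℕ) → ℕ → Set
IsOrbitMin f m = ∀ t → m ≤ iterate f m t

orbitGo-≡-applyUpTo : ∀ f s h k x → iterate f x h ≡ s → (∀ t → t < h → iterate f x t ≢ s) → h < k →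
                      orbitGo f s k x ≡ applyUpTo (iterate f x) h
orbitGo-≡-applyUpTo f s zero    (suc k) x e first _ rewrite e | ≡⇒≡ᵇ≡true {s} refl = refl
orbitGo-≡-applyUpTo f s (suc h) (suc k) x e first (s≤s h<k) rewrite ≢⇒≡ᵇ≡false (first 0 z<s) =
  cong (x ∷_) (orbitGo-≡-applyUpTo f s h k (f x) e (λ t t<h → first (suc t) (s≤s t<h)) h<k)

least-below : (P : ℕ → Set) → (∀ t → Dec (P t)) → ∀ k →
              (∀ t → t < k → ¬ P t) ⊎ ∃ λ l → l < k × P l × (∀ t → t < l → ¬ P t)
least-below P P? zero = inj₁ (λ t ())
least-below P P? (suc k) with least-below P P? k
... | inj₂ (l , l<k , pl , below) = inj₂ (l , m<n⇒m<1+n l<k , pl , below)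
... | inj₁ none with P? k
...   | yes pk = inj₂ (k , ≤-refl , pk , none)
...   | no ¬pk = inj₁ extended
  where
  extended : ∀ t → t < suc k → ¬ P t
  extended t t<1+k with m≤n⇒m<n∨m≡n (≤-pred t<1+k)
  ... | inj₁ t<k = none t t<k
  ... | inj₂ refl = ¬pk

record Period (f : ℕ → ℕ) (n m : ℕ) : Set where
  field
    h            : ℕ
    returns      : iterate f m (suc h) ≡ m
    first-return : ∀ t → t < h → iterate f m (suc t) ≢ m
    h<n          : h < n

all-applyUpTo⁻ : ∀ (p : ℕ → Bool) (g : ℕ → ℕ) L → all p (applyUpTo g L) ≡ true → ∀ t → t < L → p (g t) ≡ true
all-applyUpTo⁻ p g (suc L) e t t<L with p (g 0) in eq
all-applyUpTo⁻ p g (suc L) e zero    t<L       | true = eq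
all-applyUpTo⁻ p g (suc L) e (suc t) (s≤s t<L) | true = all-applyUpTo⁻ p (g ∘ suc) L e t t<L

all-applyUpTo⁺ : ∀ (p : ℕ → Bool) (g : ℕ → ℕ) L → (∀ t → t < L → p (g t) ≡ true) → all p (applyUpTo g L) ≡ true
all-applyUpTo⁺ p g zero    all-p = refl
all-applyUpTo⁺ p g (suc L) all-p rewrite all-p 0 z<s = all-applyUpTo⁺ p (g ∘ suc) L (λ t t<L → all-p (suc t) (s≤s t<L))

module Orbits {n f} (P : IsPerm n f) where
  open IsPerm P

  iterate-bounded : ∀ {x} → x < n → ∀ t → iterate f x t < n
  iterate-bounded x<n zero    = x<n
  iterate-bounded x<n (suc t) = iterate-bounded (bounded x<n) t

  iterate-cancel : ∀ {x} → x < n → ∀ i d → iterate f x i ≡ iterate f x (i + d) → x ≡ iterate f x d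
  iterate-cancel x<n zero    d e = e
  iterate-cancel {x} x<n (suc i) d e = iterate-cancel x<n i d
    (injective (iterate-bounded x<n i) (iterate-bounded x<n (i + d))
      (trans (sym (iterate-suc f x i)) (trans e (iterate-suc f x (i + d)))))

  returns-within : ∀ {m} → m < n → ∃ λ d → 0 < d × d ≤ n × iterate f m d ≡ m
  returns-within {m} m<n
    with i , j , i<j , e ← pigeonhole (n<1+n n) (λ (a : Fin (suc n)) → fromℕ< (iterate-bounded m<n (toℕ a))) =
    toℕ j ∸ toℕ i , m<n⇒0<n∸m i<j , ≤-trans (m∸n≤m (toℕ j) (toℕ i)) (≤-pred (toℕ<n j)) ,
    sym (iterate-cancel m<n (toℕ i) (toℕ j ∸ toℕ i) (begin
      iterate f m (toℕ i)                       ≡⟨ sym (toℕ-fromℕ< (iterate-bounded m<n (toℕ i))) ⟩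
      toℕ (fromℕ< (iterate-bounded m<n (toℕ i))) ≡⟨ cong toℕ e ⟩
      toℕ (fromℕ< (iterate-bounded m<n (toℕ j))) ≡⟨ toℕ-fromℕ< (iterate-bounded m<n (toℕ j)) ⟩
      iterate f m (toℕ j)                       ≡⟨ cong (iterate f m) (sym (m+[n∸m]≡n (<⇒≤ i<j))) ⟩
      iterate f m (toℕ i + (toℕ j ∸ toℕ i))     ∎))
    where open ≡-Reasoning

  period : ∀ {m} → m < n → Period f n m
  period {m} m<n with returns-within m<n
  ... | suc d , _ , d<n , e with least-below (λ t → iterate f m (suc t) ≡ m) (λ t → iterate f m (suc t) ≟ m) (suc d)
  ...   | inj₁ none = ⊥-elim (none d ≤-refl e)
  ...   | inj₂ (l , l<1+d , pl , below) =
          record { h = l ; returns = pl ; first-return = below ; h<n = ≤-trans l<1+d d<n }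

  module OrbitOf {m} (m<n : m < n) where
    open Period (period m<n) public

    cycleF-≡-applyUpTo : cycleF n f m ≡ applyUpTo (iterate f m) (suc h)
    cycleF-≡-applyUpTo = cong (m ∷_) (orbitGo-≡-applyUpTo f m h n (f m) returns first-return h<n)

    within-period : ∀ t → ∃ λ u → u ≤ h × iterate f m t ≡ iterate f m u
    within-period zero = 0 , z≤n , refl
    within-period (suc t) with within-period t
    ... | u , u≤h , e with m≤n⇒m<n∨m≡n u≤h
    ...   | inj₁ u<h  = suc u , u<h , trans (iterate-suc f m t) (trans (cong f e) (sym (iterate-suc f m u)))
    ...   | inj₂ refl = 0 , z≤n , trans (iterate-suc f m t) (trans (cong f e) (trans (sym (iterate-suc f m u)) returns))

    returns-to : ∀ t → ∃ λ s → iterate f (iterate f m t) s ≡ m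
    returns-to zero = 0 , refl
    returns-to (suc t) with returns-to t
    ... | suc s , e = s , trans (cong (λ z → iterate f z s) (iterate-suc f m t)) e
    ... | zero  , e = h , trans (cong (λ z → iterate f z h) (trans (iterate-suc f m t) (cong f e))) returns

    isCycleMinF⇒ : isCycleMinF n f m ≡ true → IsOrbitMin f m
    isCycleMinF⇒ e t with u , u≤h , eu ← within-period t rewrite eu =
      ≤ᵇ≡true⇒≤ (all-applyUpTo⁻ (m ≤ᵇ_) (iterate f m) (suc h) (trans (cong (all (m ≤ᵇ_)) (sym cycleF-≡-applyUpTo)) e) u (s≤s u≤h))

    isCycleMinF⇐ : IsOrbitMin f m → isCycleMinF n f m ≡ true
    isCycleMinF⇐ min = trans (cong (all (m ≤ᵇ_)) cycleF-≡-applyUpTo)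
      (all-applyUpTo⁺ (m ≤ᵇ_) (iterate f m) (suc h) (λ t _ → ≤⇒≤ᵇ≡true (min t)))

minimum-of : ∀ x xs → ∃ λ m → m ∈ x ∷ xs × All (m ≤_) (x ∷ xs)
minimum-of x []       = x , here refl , ≤-refl ∷ []
minimum-of x (y ∷ ys) with m , m∈ , m≤ ← minimum-of y ys with x ≤? m
... | yes x≤m = x , here refl , ≤-refl ∷ All.map (≤-trans x≤m) m≤
... | no  x≰m = m , there m∈ , <⇒≤ (≰⇒> x≰m) ∷ m≤

module Cycles {n f} (P : IsPerm n f) where
  open Orbits P

  IsCycleMin : ℕ → Set
  IsCycleMin m = m < n × IsOrbitMin f m

  cycleF-unique : ∀ {m} → m < n → Unique (cycleF n f m)
  cycleF-unique {m} m<n = subst Unique (sym cycleF-≡-applyUpTo) (Unique.applyUpTo⁺₁ (iterate f m) (suc h) distinct)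
    where
    open OrbitOf m<n
    distinct : ∀ {i j} → i < j → j < suc h → iterate f m i ≢ iterate f m j
    distinct {zero}  {suc j} i<j (s≤s j<h) e = first-return j j<h (sym e)
    distinct {suc i} {j}     i<j j<1+h     e = first-return (i + r) (≤-pred i+r<1+h) (begin
        iterate f m (suc i + r)               ≡⟨ iterate-+ f m (suc i) r ⟩
        iterate f (iterate f m (suc i)) r     ≡⟨ cong (λ z → iterate f z r) e ⟩
        iterate f (iterate f m j) r           ≡⟨ sym (iterate-+ f m j r) ⟩
        iterate f m (j + r)                   ≡⟨ cong (iterate f m) j+r≡1+h ⟩
        iterate f m (suc h)                   ≡⟨ returns ⟩
        m                                     ∎)
      where
      open ≡-Reasoning
      r = suc h ∸ j
      j+r≡1+h : j + r ≡ suc h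
      j+r≡1+h = m+[n∸m]≡n (<⇒≤ j<1+h)
      i+r<1+h : suc (suc i) + r ≤ suc h
      i+r<1+h = subst (suc (suc i) + r ≤_) j+r≡1+h (+-monoˡ-≤ r i<j)

  ∈-cycleF⁻ : ∀ {m y} → m < n → y ∈ cycleF n f m → ∃ λ t → y ≡ iterate f m t
  ∈-cycleF⁻ {m} {y} m<n y∈ with t , _ , e ← ∈-applyUpTo⁻ (iterate f m) (subst (y ∈_) (OrbitOf.cycleF-≡-applyUpTo m<n) y∈) = t , e

  ∈-cycleF⁺ : ∀ {m} → m < n → ∀ t → iterate f m t ∈ cycleF n f m
  ∈-cycleF⁺ {m} m<n t with u , u≤h , e ← OrbitOf.within-period m<n t =
    subst (iterate f m t ∈_) (sym (OrbitOf.cycleF-≡-applyUpTo m<n)) (subst (_∈ applyUpTo (iterate f m) (suc (OrbitOf.h m<n))) (sym e) (∈-applyUpTo⁺ (iterate f m) (s≤s u≤h)))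

  cycles-disjoint : ∀ {m m′ y} → IsCycleMin m → IsCycleMin m′ → y ∈ cycleF n f m → y ∈ cycleF n f m′ → m ≡ m′
  cycles-disjoint {m} {m′} {y} (m<n , m-min) (m′<n , m′-min) y∈ y∈′
    with t , e ← ∈-cycleF⁻ m<n y∈ | t′ , e′ ← ∈-cycleF⁻ m′<n y∈′ =
    ≤-antisym (below {t = t} {t′} m-min m′<n e e′) (below {t = t′} {t} m′-min m<n e′ e)
    where
    below : ∀ {a b t t′} → IsOrbitMin f a → b < n → y ≡ iterate f a t → y ≡ iterate f b t′ → a ≤ b
    below {a} {b} {t} {t′} a-min b<n ea eb with s , es ← OrbitOf.returns-to b<n t′ =
      subst (a ≤_) (trans (cong (λ z → iterate f z s) eb) es)
        (subst (a ≤_) (trans (iterate-+ f a t s) (cong (λ z → iterate f z s) (sym ea))) (a-min (t + s)))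

  ∈-cycleMins⁻ : ∀ {m} → m ∈ cycleMins n f → IsCycleMin m
  ∈-cycleMins⁻ m∈ with m∈upTo , min ← ∈-filterᵇ⁻ (isCycleMinF n f) m∈ =
    let m<n = ∈-upTo⁻ m∈upTo in m<n , OrbitOf.isCycleMinF⇒ m<n min

  ∈-cycleMins⁺ : ∀ {m} → IsCycleMin m → m ∈ cycleMins n f
  ∈-cycleMins⁺ (m<n , min) = ∈-filterᵇ⁺ (isCycleMinF n f) (∈-upTo⁺ m<n) (OrbitOf.isCycleMinF⇐ m<n min)

  cycle-through : ∀ {y} → y < n → ∃ λ m → IsCycleMin m × y ∈ cycleF n f m
  cycle-through {y} y<n with m , m∈ , m≤ ← minimum-of y (orbitGo f y n (f y))
                       with a , ea ← ∈-cycleF⁻ y<n m∈ =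
    m , (m<n , m-min) , y∈
    where
    m<n : m < n
    m<n = subst (_< n) (sym ea) (iterate-bounded y<n a)
    m-min : IsOrbitMin f m
    m-min t = All.lookup m≤ (subst (_∈ cycleF n f y) (trans (iterate-+ f y a t) (cong (λ z → iterate f z t) (sym ea)))
                                   (∈-cycleF⁺ y<n (a + t)))
    y∈ : y ∈ cycleF n f m
    y∈ with s , es ← OrbitOf.returns-to y<n a = subst (_∈ cycleF n f m) (trans (cong (λ z → iterate f z s) ea) es) (∈-cycleF⁺ m<n s)

  cycles-cover : concatMap (cycleF n f) (cycleMins n f) ↭ upTo n
  cycles-cover = unique-↭ cycles! (Unique.upTo⁺ n) to from
    where
    cycles! : Unique (concatMap (cycleF n f) (cycleMins n f))
    cycles! = unique-concatMap (cycleF n f) (unique-filterᵇ (isCycleMinF n f) (Unique.upTo⁺ n))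
                (λ m∈ → cycleF-unique (proj₁ (∈-cycleMins⁻ m∈)))
                (λ m∈ m′∈ → cycles-disjoint (∈-cycleMins⁻ m∈) (∈-cycleMins⁻ m′∈))
    to : ∀ {y} → y ∈ concatMap (cycleF n f) (cycleMins n f) → y ∈ upTo n
    to {y} y∈ with m , m∈ , y∈m ← ∈-concatMap-find (cycleF n f) (cycleMins n f) y∈ with m<n , _ ← ∈-cycleMins⁻ m∈
                 with t , e ← ∈-cycleF⁻ m<n y∈m = subst (_∈ upTo n) (sym e) (∈-upTo⁺ (iterate-bounded m<n t))
    from : ∀ {y} → y ∈ upTo n → y ∈ concatMap (cycleF n f) (cycleMins n f)
    from y∈ = let m , m-min , y∈m = cycle-through (∈-upTo⁻ y∈) in
      ∈-concatMap-lose (cycleF n f) {xs = cycleMins n f} (∈-cycleMins⁺ m-min) y∈m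

  ∑-by-cycles : ∀ g → ∑ n g ≡ sum (map (λ m → sum (map g (cycleF n f m))) (cycleMins n f))
  ∑-by-cycles g = begin
      ∑ n g                                                      ≡⟨ sym (sum-map-upTo g n) ⟩
      sum (map g (upTo n))                                       ≡⟨ sym (sum-↭ (Perm.map⁺ g cycles-cover)) ⟩
      sum (map g (concatMap (cycleF n f) (cycleMins n f)))       ≡⟨ sum-map-concatMap g (cycleF n f) (cycleMins n f) ⟩
      sum (map (λ m → sum (map g (cycleF n f m))) (cycleMins n f)) ∎
    where open ≡-Reasoning

-- Valleys

valleyAt : (ℕ → ℕ) → ℕ → ℕ
valleyAt f y = 𝟙 ((f y <ᵇ y) ∧ (f y <ᵇ f (f y)))

valleys : ℕ → (ℕ → ℕ) → ℕ
valleys n f = ∑ n (valleyAt f)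

valleyAt-≡ : ∀ f y {z w} → f y ≡ z → f z ≡ w → valleyAt f y ≡ 𝟙 ((z <ᵇ y) ∧ (z <ᵇ w))
valleyAt-≡ f y refl refl = refl

-- Along an orbit word w₀ … w_{L+1}, valleyAt f wₜ tests whether w_{t+1} is a valley of (wₜ, w_{t+1}, w_{t+2}):
-- all but the last two terms are the interior valleys of the word.
sum-valleyAt-orbit : ∀ f L x →
  sum (map (valleyAt f) (applyUpTo (iterate f x) (suc (suc L)))) ≡
  cvalCycle (applyUpTo (iterate f x) (suc (suc L))) + valleyAt f (iterate f x L) + valleyAt f (iterate f x (suc L))
sum-valleyAt-orbit f zero    x = cong (valleyAt f x +_) (+-identityʳ (valleyAt f (f x)))
sum-valleyAt-orbit f (suc L) x = begin
    valleyAt f x + sum (map (valleyAt f) (applyUpTo (iterate f (f x)) (suc (suc L))))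
  ≡⟨ cong (valleyAt f x +_) (sum-valleyAt-orbit f L (f x)) ⟩
    valleyAt f x + (c + a + b)
  ≡⟨ cong (valleyAt f x +_) (+-assoc c a b) ⟩
    valleyAt f x + (c + (a + b))
  ≡⟨ sym (+-assoc (valleyAt f x) c (a + b)) ⟩
    valleyAt f x + c + (a + b)
  ≡⟨ sym (+-assoc (valleyAt f x + c) a b) ⟩
    valleyAt f x + c + a + b
  ∎
  where
  open ≡-Reasoning
  c = cvalCycle (applyUpTo (iterate f (f x)) (suc (suc L)))
  a = valleyAt f (iterate f (f x) L)
  b = valleyAt f (iterate f (f x) (suc L))

-- Read cyclically, a cycle (m = c₁, …, c_ℓ) with ℓ ≥ 2 has one valley more than its cyclic valleys:
-- the minimum c₁ is a valley of (c_ℓ, c₁, c₂), while c_ℓ is never a valley of (c_{ℓ-1}, c_ℓ, c₁).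
valleys-along-cycle : ∀ f m h → iterate f m (suc h) ≡ m → (∀ t → t < h → iterate f m (suc t) ≢ m) → IsOrbitMin f m →
  sum (map (valleyAt f) (applyUpTo (iterate f m) (suc h))) ≡
  cvalCycle (applyUpTo (iterate f m) (suc h)) + 𝟙 (not (f m ≡ᵇ m))
valleys-along-cycle f m zero returns first-return m-min = begin
    valleyAt f m + 0                        ≡⟨ +-identityʳ _ ⟩
    valleyAt f m                            ≡⟨ valleyAt-≡ f m returns returns ⟩
    𝟙 ((m <ᵇ m) ∧ (m <ᵇ m))                 ≡⟨ cong (λ b → 𝟙 (b ∧ (m <ᵇ m))) (<ᵇ-irrefl m) ⟩
    0                                       ≡⟨ cong (𝟙 ∘ not) (sym (≡⇒≡ᵇ≡true returns)) ⟩
    𝟙 (not (f m ≡ᵇ m))                      ∎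
  where open ≡-Reasoning
valleys-along-cycle f m (suc L) returns first-return m-min = begin
    sum (map (valleyAt f) word)                           ≡⟨ sum-valleyAt-orbit f L m ⟩
    cvalCycle word + valleyAt f y₁ + valleyAt f y₂         ≡⟨ cong₂ (λ a b → cvalCycle word + a + b) last-not-valley first-valley ⟩
    cvalCycle word + 0 + 1                                ≡⟨ cong (_+ 1) (+-identityʳ _) ⟩
    cvalCycle word + 1                                    ≡⟨ cong (λ b → cvalCycle word + 𝟙 (not b)) (sym (≢⇒≡ᵇ≡false fm≢m)) ⟩
    cvalCycle word + 𝟙 (not (f m ≡ᵇ m))                   ∎
  where
  open ≡-Reasoning
  word = applyUpTo (iterate f m) (suc (suc L))
  y₁ = iterate f m L
  y₂ = iterate f m (suc L)
  fm≢m : f m ≢ m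
  fm≢m = first-return 0 z<s
  f-y₁ : f y₁ ≡ y₂
  f-y₁ = sym (iterate-suc f m L)
  f-y₂ : f y₂ ≡ m
  f-y₂ = trans (sym (iterate-suc f m (suc L))) returns
  last-not-valley : valleyAt f y₁ ≡ 0
  last-not-valley = begin
    valleyAt f y₁                    ≡⟨ valleyAt-≡ f y₁ f-y₁ f-y₂ ⟩
    𝟙 ((y₂ <ᵇ y₁) ∧ (y₂ <ᵇ m))       ≡⟨ cong (λ b → 𝟙 ((y₂ <ᵇ y₁) ∧ b)) (≮⇒<ᵇ≡false (≤⇒≯ (m-min (suc L)))) ⟩
    𝟙 ((y₂ <ᵇ y₁) ∧ false)           ≡⟨ cong 𝟙 (∧-zeroʳ (y₂ <ᵇ y₁)) ⟩
    0                                ∎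
  first-valley : valleyAt f y₂ ≡ 1
  first-valley = trans (valleyAt-≡ f y₂ f-y₂ refl)
    (cong₂ (λ a b → 𝟙 (a ∧ b)) (<⇒<ᵇ≡true (≤∧≢⇒< (m-min (suc L)) (λ e → first-return L ≤-refl (sym e))))
                                (<⇒<ᵇ≡true (≤∧≢⇒< (m-min 1) (fm≢m ∘ sym))))

𝟙-split : ∀ a b → (b ≡ true → a ≡ true) → 𝟙 a ≡ (if a then 𝟙 (not b) else 0) + 𝟙 b
𝟙-split true  true  _ = refl
𝟙-split true  false _ = refl
𝟙-split false true  b⇒a with () ← b⇒a refl
𝟙-split false false _ = refl

module ValleysOfPerm {n f} (P : IsPerm n f) where
  open Cycles P

  nonFixedCycles : ℕ
  nonFixedCycles = sum (map (λ m → 𝟙 (not (f m ≡ᵇ m))) (cycleMins n f))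

  valleys≡cval+nonFixedCycles : valleys n f ≡ cvalF n f + nonFixedCycles
  valleys≡cval+nonFixedCycles = begin
      ∑ n (valleyAt f)
    ≡⟨ ∑-by-cycles (valleyAt f) ⟩
      sum (map (λ m → sum (map (valleyAt f) (cycleF n f m))) (cycleMins n f))
    ≡⟨ sum-map-cong _ _ (cycleMins n f) along-cycle ⟩
      sum (map (λ m → cvalCycle (cycleF n f m) + 𝟙 (not (f m ≡ᵇ m))) (cycleMins n f))
    ≡⟨ sum-map-+ (cvalCycle ∘ cycleF n f) (λ m → 𝟙 (not (f m ≡ᵇ m))) (cycleMins n f) ⟩
      sum (map (cvalCycle ∘ cycleF n f) (cycleMins n f)) + nonFixedCycles
    ≡⟨ cong (λ l → sum l + nonFixedCycles) (map-∘ (cycleMins n f)) ⟩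
      cvalF n f + nonFixedCycles ∎
    where
    open ≡-Reasoning
    along-cycle : ∀ m → m ∈ cycleMins n f → sum (map (valleyAt f) (cycleF n f m)) ≡ cvalCycle (cycleF n f m) + 𝟙 (not (f m ≡ᵇ m))
    along-cycle m m∈ with m<n , m-min ← ∈-cycleMins⁻ m∈ =
      trans (cong (sum ∘ map (valleyAt f)) cycleF-≡-applyUpTo)
        (trans (valleys-along-cycle f m h returns first-return m-min)
               (cong (λ l → cvalCycle l + 𝟙 (not (f m ≡ᵇ m))) (sym cycleF-≡-applyUpTo)))
      where open Orbits.OrbitOf P m<n

  cyc≡nonFixedCycles+fix : cycF n f ≡ nonFixedCycles + fixF n f
  cyc≡nonFixedCycles+fix = begin
      length (map (cycleF n f) (cycleMins n f))
    ≡⟨ length-map (cycleF n f) (cycleMins n f) ⟩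
      length (cycleMins n f)
    ≡⟨ count-upTo (isCycleMinF n f) n ⟩
      ∑ n (𝟙 ∘ isCycleMinF n f)
    ≡⟨ ∑-cong n split ⟩
      ∑ n (λ y → (if isCycleMinF n f y then 𝟙 (not (f y ≡ᵇ y)) else 0) + 𝟙 (f y ≡ᵇ y))
    ≡⟨ ∑-+ n _ _ ⟩
      ∑ n (λ y → if isCycleMinF n f y then 𝟙 (not (f y ≡ᵇ y)) else 0) + ∑ n (λ y → 𝟙 (f y ≡ᵇ y))
    ≡⟨ cong₂ _+_ (sym (trans (sum-map-filterᵇ (isCycleMinF n f) (λ m → 𝟙 (not (f m ≡ᵇ m))) (upTo n)) (sum-map-upTo _ n)))
                 (sym (count-upTo (λ y → f y ≡ᵇ y) n)) ⟩
      nonFixedCycles + fixF n f ∎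
    where
    open ≡-Reasoning
    fixed-is-cycle : ∀ y → y < n → (f y ≡ᵇ y) ≡ true → isCycleMinF n f y ≡ true
    fixed-is-cycle y y<n e = Orbits.OrbitOf.isCycleMinF⇐ P y<n (λ t → ≤-reflexive (sym (iterate-fixed f (≡ᵇ≡true⇒≡ e) t)))
    split : ∀ y → y < n → 𝟙 (isCycleMinF n f y) ≡ (if isCycleMinF n f y then 𝟙 (not (f y ≡ᵇ y)) else 0) + 𝟙 (f y ≡ᵇ y)
    split y y<n = 𝟙-split (isCycleMinF n f y) (f y ≡ᵇ y) (fixed-is-cycle y y<n)

  cval+cyc≡valleys+fix : cvalF n f + cycF n f ≡ valleys n f + fixF n f
  cval+cyc≡valleys+fix = begin
    cvalF n f + cycF n f                          ≡⟨ cong (cvalF n f +_) cyc≡nonFixedCycles+fix ⟩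
    cvalF n f + (nonFixedCycles + fixF n f)       ≡⟨ sym (+-assoc (cvalF n f) nonFixedCycles (fixF n f)) ⟩
    cvalF n f + nonFixedCycles + fixF n f         ≡⟨ cong (_+ fixF n f) (sym valleys≡cval+nonFixedCycles) ⟩
    valleys n f + fixF n f                        ∎
    where open ≡-Reasoning

-- Inserting n right after c in the cycle of c (as a new fixed point when c = n)

insertAfter : ℕ → (ℕ → ℕ) → ℕ → ℕ → ℕ
insertAfter n σ c y = if y ≡ᵇ c then n else (if y ≡ᵇ n then σ c else σ y)

data InsertView (n : ℕ) (σ : ℕ → ℕ) (c y : ℕ) : Set where
  at-c      : y ≡ c → insertAfter n σ c y ≡ n → InsertView n σ c y
  at-n      : y ≡ n → y ≢ c → insertAfter n σ c y ≡ σ c → InsertView n σ c y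
  elsewhere : y ≢ c → y ≢ n → insertAfter n σ c y ≡ σ y → InsertView n σ c y

insertView : ∀ n σ c y → InsertView n σ c y
insertView n σ c y with y ≟ c
... | yes y≡c = at-c y≡c (cong (if_then n else (if y ≡ᵇ n then σ c else σ y)) (≡⇒≡ᵇ≡true y≡c))
... | no  y≢c with y ≟ n
...   | yes y≡n = at-n y≡n y≢c (trans (cong (if_then n else (if y ≡ᵇ n then σ c else σ y)) (≢⇒≡ᵇ≡false y≢c))
                                      (cong (if_then σ c else σ y) (≡⇒≡ᵇ≡true y≡n)))
...   | no  y≢n = elsewhere y≢c y≢n (trans (cong (if_then n else (if y ≡ᵇ n then σ c else σ y)) (≢⇒≡ᵇ≡false y≢c))
                                           (cong (if_then σ c else σ y) (≢⇒≡ᵇ≡false y≢n)))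

insertAfter-c : ∀ n σ c → insertAfter n σ c c ≡ n
insertAfter-c n σ c with insertView n σ c c
... | at-c _ e        = e
... | at-n _ c≢c _    = ⊥-elim (c≢c refl)
... | elsewhere c≢c _ _ = ⊥-elim (c≢c refl)

insertAfter-n : ∀ n σ {c} → c ≢ n → insertAfter n σ c n ≡ σ c
insertAfter-n n σ {c} c≢n with insertView n σ c n
... | at-c n≡c _        = ⊥-elim (c≢n (sym n≡c))
... | at-n _ _ e        = e
... | elsewhere _ n≢n _ = ⊥-elim (n≢n refl)

insertAfter-other : ∀ n σ {c y} → y ≢ c → y ≢ n → insertAfter n σ c y ≡ σ y
insertAfter-other n σ {c} {y} y≢c y≢n with insertView n σ c y
... | at-c y≡c _      = ⊥-elim (y≢c y≡c)
... | at-n y≡n _ _    = ⊥-elim (y≢n y≡n)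
... | elsewhere _ _ e = e

bool-ext : ∀ {a b : Bool} → (a ≡ true → b ≡ true) → (b ≡ true → a ≡ true) → a ≡ b
bool-ext {true}  {true}  _ _ = refl
bool-ext {true}  {false} f _ = sym (f refl)
bool-ext {false} {true}  _ g = g refl
bool-ext {false} {false} _ _ = refl

module Insertion {n σ} (P : IsPerm n σ) (c : ℕ) (c≤n : c ≤ n) where
  open IsPerm P
  open Orbits P using (iterate-bounded)

  τ : ℕ → ℕ
  τ = insertAfter n σ c

  c<n : c ≢ n → c < n
  c<n = ≤∧≢⇒< c≤n

  y<n : ∀ {y} → y < suc n → y ≢ n → y < n
  y<n y<1+n = ≤∧≢⇒< (≤-pred y<1+n)

  τ-isPerm : IsPerm (suc n) τ
  τ-isPerm = record
    { bounded         = τ-bounded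
    ; identity-beyond = λ {y} n<y → trans (insertAfter-other n σ (λ y≡c → <⇒≱ (s≤s c≤n) (subst (suc n ≤_) y≡c n<y))
                                                                 (λ y≡n → <⇒≢ n<y (sym y≡n)))
                                          (identity-beyond (≤-trans (n≤1+n n) n<y))
    ; injective       = τ-injective
    ; surjective      = τ-surjective
    }
    where
    τ-bounded : ∀ {y} → y < suc n → τ y < suc n
    τ-bounded {y} y<1+n with insertView n σ c y
    ... | at-c _ e             rewrite e = ≤-refl
    ... | at-n refl c≢n e      rewrite e = m<n⇒m<1+n (bounded (c<n (c≢n ∘ sym)))
    ... | elsewhere _ y≢n e    rewrite e = m<n⇒m<1+n (bounded (y<n y<1+n y≢n))

    τ-injective : ∀ {y z} → y < suc n → z < suc n → τ y ≡ τ z → y ≡ z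
    τ-injective {y} {z} y< z< e with insertView n σ c y | insertView n σ c z
    ... | at-c a _ | at-c b _ = trans a (sym b)
    ... | at-c _ p | at-n refl n≢c q = ⊥-elim (<⇒≢ (bounded (c<n (n≢c ∘ sym))) (sym (trans (sym p) (trans e q))))
    ... | at-c _ p | elsewhere _ z≢n q = ⊥-elim (<⇒≢ (bounded (y<n z< z≢n)) (sym (trans (sym p) (trans e q))))
    ... | at-n refl n≢c q | at-c _ p = ⊥-elim (<⇒≢ (bounded (c<n (n≢c ∘ sym))) (trans (sym q) (trans e p)))
    ... | at-n a _ _ | at-n b _ _ = trans a (sym b)
    ... | at-n refl n≢c q | elsewhere z≢c z≢n r =
          ⊥-elim (z≢c (sym (injective (c<n (n≢c ∘ sym)) (y<n z< z≢n) (trans (sym q) (trans e r)))))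
    ... | elsewhere _ y≢n q | at-c _ p = ⊥-elim (<⇒≢ (bounded (y<n y< y≢n)) (trans (sym q) (trans e p)))
    ... | elsewhere y≢c y≢n r | at-n refl n≢c q =
          ⊥-elim (y≢c (injective (y<n y< y≢n) (c<n (n≢c ∘ sym)) (trans (sym r) (trans e q))))
    ... | elsewhere _ y≢n q | elsewhere _ z≢n r = injective (y<n y< y≢n) (y<n z< z≢n) (trans (sym q) (trans e r))

    τ-surjective : ∀ {x} → x < suc n → ∃ λ y → y < suc n × τ y ≡ x
    τ-surjective {x} x<1+n with x ≟ n
    ... | yes refl = c , s≤s c≤n , insertAfter-c n σ c
    ... | no x≢n with y , y<n′ , e ← surjective (y<n x<1+n x≢n) with y ≟ c
    ...   | yes refl = n , ≤-refl , trans (insertAfter-n n σ (<⇒≢ y<n′)) e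
    ...   | no y≢c   = y , m<n⇒m<1+n y<n′ , trans (insertAfter-other n σ y≢c (<⇒≢ y<n′)) e

  σ-orbit-in-τ-orbit : ∀ {y} → y < n → ∀ t → ∃ λ u → iterate σ y t ≡ iterate τ y u
  σ-orbit-in-τ-orbit y<n zero = 0 , refl
  σ-orbit-in-τ-orbit {y} y<n (suc t) with u , e ← σ-orbit-in-τ-orbit y<n t with insertView n σ c (iterate σ y t)
  ... | at-c a p = suc (suc u) , (begin
      iterate σ y (suc t)         ≡⟨ iterate-suc σ y t ⟩
      σ (iterate σ y t)           ≡⟨ cong σ a ⟩
      σ c                         ≡⟨ sym (insertAfter-n n σ (λ c≡n → <⇒≢ (subst (_< n) a (iterate-bounded y<n t)) c≡n)) ⟩
      τ n                         ≡⟨ cong τ (sym p) ⟩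
      τ (τ (iterate σ y t))       ≡⟨ cong (τ ∘ τ) e ⟩
      τ (τ (iterate τ y u))       ≡⟨ cong τ (sym (iterate-suc τ y u)) ⟩
      τ (iterate τ y (suc u))     ≡⟨ sym (iterate-suc τ y (suc u)) ⟩
      iterate τ y (suc (suc u))   ∎)
    where open ≡-Reasoning
  ... | at-n a _ _      = ⊥-elim (<⇒≢ (iterate-bounded y<n t) a)
  ... | elsewhere _ _ p = suc u , trans (iterate-suc σ y t) (trans (sym p) (trans (cong τ e) (sym (iterate-suc τ y u))))

  τ-orbit-in-σ-orbit : ∀ {y} → y < n → ∀ u →
    (∃ λ t → iterate τ y u ≡ iterate σ y t) ⊎ (iterate τ y u ≡ n × ∃ λ t → iterate σ y t ≡ c)
  τ-orbit-in-σ-orbit y<n zero = inj₁ (0 , refl)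
  τ-orbit-in-σ-orbit {y} y<n (suc u) with τ-orbit-in-σ-orbit y<n u
  ... | inj₁ (t , e) with insertView n σ c (iterate σ y t)
  ...   | at-c a p        = inj₂ (trans (iterate-suc τ y u) (trans (cong τ e) p) , t , a)
  ...   | at-n a _ _      = ⊥-elim (<⇒≢ (iterate-bounded y<n t) a)
  ...   | elsewhere _ _ p = inj₁ (suc t , trans (iterate-suc τ y u) (trans (cong τ e) (trans p (sym (iterate-suc σ y t)))))
  τ-orbit-in-σ-orbit {y} y<n (suc u) | inj₂ (e , t , a) =
    inj₁ (suc t , trans (iterate-suc τ y u) (trans (cong τ e) (trans (insertAfter-n n σ c≢n)
                    (trans (cong σ (sym a)) (sym (iterate-suc σ y t))))))
    where
    c≢n : c ≢ n
    c≢n c≡n = <⇒≢ (iterate-bounded y<n t) (trans a c≡n)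

  isCycleMinF-τ : ∀ {y} → y < n → isCycleMinF (suc n) τ y ≡ isCycleMinF n σ y
  isCycleMinF-τ {y} y<n = bool-ext
    (λ e → Orbits.OrbitOf.isCycleMinF⇐ P y<n (τ-min⇒σ-min (Orbits.OrbitOf.isCycleMinF⇒ τ-isPerm (m<n⇒m<1+n y<n) e)))
    (λ e → Orbits.OrbitOf.isCycleMinF⇐ τ-isPerm (m<n⇒m<1+n y<n) (σ-min⇒τ-min (Orbits.OrbitOf.isCycleMinF⇒ P y<n e)))
    where
    τ-min⇒σ-min : IsOrbitMin τ y → IsOrbitMin σ y
    τ-min⇒σ-min min t with u , e ← σ-orbit-in-τ-orbit y<n t = subst (y ≤_) (sym e) (min u)
    σ-min⇒τ-min : IsOrbitMin σ y → IsOrbitMin τ y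
    σ-min⇒τ-min min u with τ-orbit-in-σ-orbit y<n u
    ... | inj₁ (t , e) = subst (y ≤_) (sym e) (min t)
    ... | inj₂ (e , _) = subst (y ≤_) (sym e) (<⇒≤ y<n)

  isCycleMinF-τ-n : isCycleMinF (suc n) τ n ≡ (c ≡ᵇ n)
  isCycleMinF-τ-n with c ≟ n
  ... | yes refl = trans (Orbits.OrbitOf.isCycleMinF⇐ τ-isPerm ≤-refl
                            (λ t → ≤-reflexive (sym (iterate-fixed τ (insertAfter-c c σ c) t))))
                         (sym (≡⇒≡ᵇ≡true {c} refl))
  ... | no c≢n = trans (bool-ext {b = false} (λ e → ⊥-elim (<⇒≱ (bounded (c<n c≢n))
                          (subst (n ≤_) (insertAfter-n n σ c≢n) (Orbits.OrbitOf.isCycleMinF⇒ τ-isPerm ≤-refl e 1)))) λ ())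
                       (sym (≢⇒≡ᵇ≡false c≢n))

  cycF-τ : cycF (suc n) τ ≡ cycF n σ + 𝟙 (c ≡ᵇ n)
  cycF-τ = begin
      length (map (cycleF (suc n) τ) (cycleMins (suc n) τ))
    ≡⟨ length-map (cycleF (suc n) τ) (cycleMins (suc n) τ) ⟩
      length (cycleMins (suc n) τ)
    ≡⟨ count-upTo (isCycleMinF (suc n) τ) (suc n) ⟩
      ∑ n (𝟙 ∘ isCycleMinF (suc n) τ) + 𝟙 (isCycleMinF (suc n) τ n)
    ≡⟨ cong₂ _+_ (∑-cong n (λ y y<n → cong 𝟙 (isCycleMinF-τ y<n))) (cong 𝟙 isCycleMinF-τ-n) ⟩
      ∑ n (𝟙 ∘ isCycleMinF n σ) + 𝟙 (c ≡ᵇ n)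
    ≡⟨ cong (_+ 𝟙 (c ≡ᵇ n)) (sym (trans (length-map (cycleF n σ) (cycleMins n σ)) (count-upTo (isCycleMinF n σ) n))) ⟩
      cycF n σ + 𝟙 (c ≡ᵇ n) ∎
    where open ≡-Reasoning

cval-change : ∀ {cv cy w cv′ cy′ w′} δ → cv + cy ≡ w → cv′ + cy′ ≡ w′ → w′ + cy ≡ w + cy′ + δ → cv′ ≡ cv + δ
cval-change {cv} {cy} {w} {cv′} {cy′} {w′} δ e e′ shift = +-cancelʳ-≡ (cy′ + cy) cv′ (cv + δ) (begin
    cv′ + (cy′ + cy)     ≡⟨ sym (+-assoc cv′ cy′ cy) ⟩
    cv′ + cy′ + cy       ≡⟨ cong (_+ cy) e′ ⟩
    w′ + cy              ≡⟨ shift ⟩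
    w + cy′ + δ          ≡⟨ cong (λ z → z + cy′ + δ) (sym e) ⟩
    cv + cy + cy′ + δ    ≡⟨ regroup cv cy cy′ δ ⟩
    cv + δ + (cy′ + cy)  ∎)
  where
  open ≡-Reasoning
  regroup : ∀ a b c d → a + b + c + d ≡ a + d + (c + b)
  regroup = solve-∀

fixF-≡-∑ : ∀ N f → fixF N f ≡ ∑ N (λ y → 𝟙 (f y ≡ᵇ y))
fixF-≡-∑ N f = count-upTo (λ y → f y ≡ᵇ y) N

gain-regroup : ∀ a b u → 𝟙 a + 𝟙 b ≡ 𝟙 (not u ∧ b) + 𝟙 (a ∧ u) + (𝟙 (a ∧ not u) + 𝟙 (u ∧ b))
gain-regroup true  true  true  = refl
gain-regroup true  true  false = refl
gain-regroup true  false true  = refl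
gain-regroup true  false false = refl
gain-regroup false true  true  = refl
gain-regroup false true  false = refl
gain-regroup false false true  = refl
gain-regroup false false false = refl

module Inverse {n σ} (P : IsPerm n σ) where
  open IsPerm P

  opaque
    σ⁻¹ : ℕ → ℕ
    σ⁻¹ x with x <? n
    ... | yes x<n = proj₁ (surjective x<n)
    ... | no  _   = x

    σ⁻¹-inverseʳ : ∀ {x} → x < n → σ⁻¹ x < n × σ (σ⁻¹ x) ≡ x
    σ⁻¹-inverseʳ {x} x<n with x <? n
    ... | yes x<n′ = proj₂ (surjective x<n′)
    ... | no  x≮n  = ⊥-elim (x≮n x<n)

  σ⁻¹-inverseˡ : ∀ {y} → y < n → σ⁻¹ (σ y) ≡ y
  σ⁻¹-inverseˡ y<n = let inv<n , σ-inv = σ⁻¹-inverseʳ (bounded y<n) in injective inv<n y<n σ-inv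

  -- The cyclic valleys gained when n is inserted between c and σ c ≠ c: c becomes a valley of (σ⁻¹ c, c, n)
  -- when it was not one of (σ⁻¹ c, c, σ c), and σ c becomes one of (n, σ c, σ² c) when it was not one of (c, σ c, σ² c).
  valleyGain : ℕ → ℕ
  valleyGain c = 𝟙 ((c <ᵇ σ⁻¹ c) ∧ (σ c <ᵇ c)) + 𝟙 ((c <ᵇ σ c) ∧ (σ c <ᵇ σ (σ c)))

module InsertionStatistics {n σ} (P : IsPerm n σ) (c : ℕ) (c≤n : c ≤ n) where
  open IsPerm P
  open Insertion P c c≤n
  open Inverse P
  open ValleysOfPerm using (cval+cyc≡valleys+fix)

  τ-elsewhere : ∀ {y} → y < n → y ≢ c → τ y ≡ σ y
  τ-elsewhere y<n y≢c = insertAfter-other n σ y≢c (<⇒≢ y<n)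

  cycF-τ-c<n : c < n → cycF (suc n) τ ≡ cycF n σ
  cycF-τ-c<n c<n = trans cycF-τ (trans (cong (λ b → cycF n σ + 𝟙 b) (≢⇒≡ᵇ≡false (<⇒≢ c<n))) (+-identityʳ _))

  module AtEnd (c≡n : c ≡ n) where
    τ-n : τ n ≡ n
    τ-n = trans (cong τ (sym c≡n)) (insertAfter-c n σ c)

    τ-<n : ∀ {y} → y < n → τ y ≡ σ y
    τ-<n y<n = τ-elsewhere y<n (λ y≡c → <⇒≢ y<n (trans y≡c c≡n))

    fix-τ : fixF (suc n) τ ≡ fixF n σ + 1
    fix-τ = begin
        fixF (suc n) τ                                         ≡⟨ fixF-≡-∑ (suc n) τ ⟩
        ∑ n (λ y → 𝟙 (τ y ≡ᵇ y)) + 𝟙 (τ n ≡ᵇ n)               ≡⟨ cong₂ _+_ (∑-cong n (λ y y<n → cong (λ z → 𝟙 (z ≡ᵇ y)) (τ-<n y<n)))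
                                                                            (cong 𝟙 (≡⇒≡ᵇ≡true τ-n)) ⟩
        ∑ n (λ y → 𝟙 (σ y ≡ᵇ y)) + 1                          ≡⟨ cong (_+ 1) (sym (fixF-≡-∑ n σ)) ⟩
        fixF n σ + 1                                           ∎
      where open ≡-Reasoning

    valleys-τ : valleys (suc n) τ ≡ valleys n σ
    valleys-τ = trans (cong₂ _+_ (∑-cong n unchanged) no-valley-at-n) (+-identityʳ _)
      where
      unchanged : ∀ y → y < n → valleyAt τ y ≡ valleyAt σ y
      unchanged y y<n = valleyAt-≡ τ y (τ-<n y<n) (τ-<n (bounded y<n))
      no-valley-at-n : valleyAt τ n ≡ 0
      no-valley-at-n = trans (valleyAt-≡ τ n τ-n τ-n) (cong (λ b → 𝟙 (b ∧ (n <ᵇ n))) (<ᵇ-irrefl n))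

  module AtFixed (c<n : c < n) (σc≡c : σ c ≡ c) where
    τ-n : τ n ≡ c
    τ-n = trans (insertAfter-n n σ (<⇒≢ c<n)) σc≡c

    fix-τ : fixF (suc n) τ + 1 ≡ fixF n σ
    fix-τ = begin
        fixF (suc n) τ + 1                                           ≡⟨ cong (_+ 1) (fixF-≡-∑ (suc n) τ) ⟩
        ∑ n (λ y → 𝟙 (τ y ≡ᵇ y)) + 𝟙 (τ n ≡ᵇ n) + 1                 ≡⟨ cong (λ z → ∑ n (λ y → 𝟙 (τ y ≡ᵇ y)) + 𝟙 z + 1)
                                                                              (trans (cong (_≡ᵇ n) τ-n) (≢⇒≡ᵇ≡false (<⇒≢ c<n))) ⟩
        ∑ n (λ y → 𝟙 (τ y ≡ᵇ y)) + 0 + 1                            ≡⟨ cong₂ _+_ (+-identityʳ _) (cong 𝟙 (sym (≡⇒≡ᵇ≡true σc≡c))) ⟩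
        ∑ n (λ y → 𝟙 (τ y ≡ᵇ y)) + 𝟙 (σ c ≡ᵇ c)                     ≡⟨ ∑-update n c<n _ _ (λ y y<n y≢c → cong (λ z → 𝟙 (z ≡ᵇ y)) (τ-elsewhere y<n y≢c)) ⟩
        ∑ n (λ y → 𝟙 (σ y ≡ᵇ y)) + 𝟙 (τ c ≡ᵇ c)                     ≡⟨ cong (λ z → ∑ n (λ y → 𝟙 (σ y ≡ᵇ y)) + 𝟙 (z ≡ᵇ c)) (insertAfter-c n σ c) ⟩
        ∑ n (λ y → 𝟙 (σ y ≡ᵇ y)) + 𝟙 (n ≡ᵇ c)                       ≡⟨ cong (λ z → ∑ n (λ y → 𝟙 (σ y ≡ᵇ y)) + 𝟙 z) (≢⇒≡ᵇ≡false (<⇒≢ c<n ∘ sym)) ⟩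
        ∑ n (λ y → 𝟙 (σ y ≡ᵇ y)) + 0                                ≡⟨ +-identityʳ _ ⟩
        ∑ n (λ y → 𝟙 (σ y ≡ᵇ y))                                    ≡⟨ sym (fixF-≡-∑ n σ) ⟩
        fixF n σ                                                      ∎
      where open ≡-Reasoning

    valleys-τ : valleys (suc n) τ ≡ valleys n σ + 1
    valleys-τ = cong₂ _+_ (∑-cong n unchanged) valley-at-n
      where
      unchanged : ∀ y → y < n → valleyAt τ y ≡ valleyAt σ y
      unchanged y y<n with y ≟ c
      ... | yes refl = trans (valleyAt-≡ τ y (insertAfter-c n σ y) τ-n)
                             (trans (cong (λ b → 𝟙 (b ∧ (n <ᵇ y))) (≮⇒<ᵇ≡false (<⇒≯ c<n)))
                                    (sym (trans (valleyAt-≡ σ y σc≡c σc≡c) (cong (λ b → 𝟙 (b ∧ (y <ᵇ y))) (<ᵇ-irrefl y)))))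
      ... | no  y≢c  = valleyAt-≡ τ y (τ-elsewhere y<n y≢c)
                         (τ-elsewhere (bounded y<n) (λ σy≡c → y≢c (injective y<n c<n (trans σy≡c (sym σc≡c)))))
      valley-at-n : valleyAt τ n ≡ 1
      valley-at-n = trans (valleyAt-≡ τ n τ-n (insertAfter-c n σ c)) (cong (λ b → 𝟙 (b ∧ b)) (<⇒<ᵇ≡true c<n))

  module AtMoved (c<n : c < n) (σc≢c : σ c ≢ c) where
    p = σ⁻¹ c
    p<n : p < n
    p<n = proj₁ (σ⁻¹-inverseʳ c<n)
    σp≡c : σ p ≡ c
    σp≡c = proj₂ (σ⁻¹-inverseʳ c<n)
    p≢c : p ≢ c
    p≢c p≡c = σc≢c (trans (cong σ (sym p≡c)) σp≡c)
    τ-n : τ n ≡ σ c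
    τ-n = insertAfter-n n σ (<⇒≢ c<n)
    τ-σc : τ (σ c) ≡ σ (σ c)
    τ-σc = τ-elsewhere (bounded c<n) σc≢c

    fix-τ : fixF (suc n) τ ≡ fixF n σ
    fix-τ = begin
        fixF (suc n) τ                                ≡⟨ fixF-≡-∑ (suc n) τ ⟩
        ∑ n (λ y → 𝟙 (τ y ≡ᵇ y)) + 𝟙 (τ n ≡ᵇ n)      ≡⟨ cong₂ _+_ (∑-cong n unchanged)
                                                                   (cong 𝟙 (trans (cong (_≡ᵇ n) τ-n) (≢⇒≡ᵇ≡false (<⇒≢ (bounded c<n))))) ⟩
        ∑ n (λ y → 𝟙 (σ y ≡ᵇ y)) + 0                 ≡⟨ +-identityʳ _ ⟩
        ∑ n (λ y → 𝟙 (σ y ≡ᵇ y))                     ≡⟨ sym (fixF-≡-∑ n σ) ⟩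
        fixF n σ                                       ∎
      where
      open ≡-Reasoning
      unchanged : ∀ y → y < n → 𝟙 (τ y ≡ᵇ y) ≡ 𝟙 (σ y ≡ᵇ y)
      unchanged y y<n with y ≟ c
      ... | yes refl = cong 𝟙 (trans (cong (_≡ᵇ y) (insertAfter-c n σ y))
                                     (trans (≢⇒≡ᵇ≡false (<⇒≢ y<n ∘ sym)) (sym (≢⇒≡ᵇ≡false σc≢c))))
      ... | no  y≢c  = cong (λ z → 𝟙 (z ≡ᵇ y)) (τ-elsewhere y<n y≢c)

    valleys-τ : valleys (suc n) τ ≡ valleys n σ + valleyGain c
    valleys-τ = +-cancelʳ-≡ (valleyAt σ c + valleyAt σ p) _ _ (begin
        ∑ n (valleyAt τ) + valleyAt τ n + (valleyAt σ c + valleyAt σ p)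
      ≡⟨ xy∙z≈xz∙y (∑ n (valleyAt τ)) (valleyAt τ n) _ ⟩
        ∑ n (valleyAt τ) + (valleyAt σ c + valleyAt σ p) + valleyAt τ n
      ≡⟨ cong₂ _+_ (∑-update₂ n c<n p<n (p≢c ∘ sym) (valleyAt τ) (valleyAt σ) unchanged) valley-at-n ⟩
        ∑ n (valleyAt σ) + (valleyAt τ c + valleyAt τ p) + 𝟙 (σ c <ᵇ σ (σ c))
      ≡⟨ cong (λ z → ∑ n (valleyAt σ) + z + 𝟙 (σ c <ᵇ σ (σ c))) (cong₂ _+_ no-valley-at-c valley-at-p) ⟩
        ∑ n (valleyAt σ) + 𝟙 (c <ᵇ p) + 𝟙 (σ c <ᵇ σ (σ c))
      ≡⟨ +-assoc (∑ n (valleyAt σ)) _ _ ⟩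
        ∑ n (valleyAt σ) + (𝟙 (c <ᵇ p) + 𝟙 (σ c <ᵇ σ (σ c)))
      ≡⟨ cong (∑ n (valleyAt σ) +_) gain ⟩
        ∑ n (valleyAt σ) + (valleyAt σ c + valleyAt σ p + valleyGain c)
      ≡⟨ regroup (∑ n (valleyAt σ)) (valleyAt σ c + valleyAt σ p) (valleyGain c) ⟩
        ∑ n (valleyAt σ) + valleyGain c + (valleyAt σ c + valleyAt σ p)
      ∎)
      where
      open ≡-Reasoning
      regroup : ∀ a b d → a + (b + d) ≡ a + d + b
      regroup = solve-∀
      unchanged : ∀ y → y < n → y ≢ c → y ≢ p → valleyAt τ y ≡ valleyAt σ y
      unchanged y y<n y≢c y≢p = valleyAt-≡ τ y (τ-elsewhere y<n y≢c)
        (τ-elsewhere (bounded y<n) (λ σy≡c → y≢p (injective y<n p<n (trans σy≡c (sym σp≡c)))))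
      valley-at-n : valleyAt τ n ≡ 𝟙 (σ c <ᵇ σ (σ c))
      valley-at-n = trans (valleyAt-≡ τ n τ-n τ-σc) (cong (λ b → 𝟙 (b ∧ (σ c <ᵇ σ (σ c)))) (<⇒<ᵇ≡true (bounded c<n)))
      no-valley-at-c : valleyAt τ c ≡ 0
      no-valley-at-c = trans (valleyAt-≡ τ c (insertAfter-c n σ c) τ-n) (cong (λ b → 𝟙 (b ∧ (n <ᵇ σ c))) (≮⇒<ᵇ≡false (<⇒≯ c<n)))
      valley-at-p : valleyAt τ p ≡ 𝟙 (c <ᵇ p)
      valley-at-p = trans (valleyAt-≡ τ p (trans (τ-elsewhere p<n p≢c) σp≡c) (insertAfter-c n σ c))
                          (trans (cong (λ b → 𝟙 ((c <ᵇ p) ∧ b)) (<⇒<ᵇ≡true c<n)) (cong 𝟙 (∧-identityʳ (c <ᵇ p))))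
      gain : 𝟙 (c <ᵇ p) + 𝟙 (σ c <ᵇ σ (σ c)) ≡ valleyAt σ c + valleyAt σ p + valleyGain c
      gain = begin
          𝟙 (c <ᵇ p) + 𝟙 (σ c <ᵇ σ (σ c))
        ≡⟨ gain-regroup (c <ᵇ p) (σ c <ᵇ σ (σ c)) (c <ᵇ σ c) ⟩
          𝟙 (not (c <ᵇ σ c) ∧ (σ c <ᵇ σ (σ c))) + 𝟙 ((c <ᵇ p) ∧ (c <ᵇ σ c))
            + (𝟙 ((c <ᵇ p) ∧ not (c <ᵇ σ c)) + 𝟙 ((c <ᵇ σ c) ∧ (σ c <ᵇ σ (σ c))))
        ≡⟨ cong (λ w → 𝟙 (w ∧ (σ c <ᵇ σ (σ c))) + 𝟙 ((c <ᵇ p) ∧ (c <ᵇ σ c))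
                       + (𝟙 ((c <ᵇ p) ∧ w) + 𝟙 ((c <ᵇ σ c) ∧ (σ c <ᵇ σ (σ c)))))
                (sym (<ᵇ-swap (σc≢c ∘ sym))) ⟩
          valleyAt σ c + 𝟙 ((c <ᵇ p) ∧ (c <ᵇ σ c)) + valleyGain c
        ≡⟨ cong (λ z → valleyAt σ c + z + valleyGain c) (sym (valleyAt-≡ σ p σp≡c refl)) ⟩
          valleyAt σ c + valleyAt σ p + valleyGain c
        ∎

  statistics-at-end : c ≡ n → cvalF (suc n) τ ≡ cvalF n σ × cycF (suc n) τ ≡ cycF n σ + 1 × fixF (suc n) τ ≡ fixF n σ + 1
  statistics-at-end c≡n = cv , cy , fix-τ
    where
    open AtEnd c≡n
    cy : cycF (suc n) τ ≡ cycF n σ + 1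
    cy = trans cycF-τ (cong (λ b → cycF n σ + 𝟙 b) (≡⇒≡ᵇ≡true c≡n))
    shift : valleys (suc n) τ + fixF (suc n) τ + cycF n σ ≡ valleys n σ + fixF n σ + cycF (suc n) τ + 0
    shift = begin
      valleys (suc n) τ + fixF (suc n) τ + cycF n σ  ≡⟨ cong₂ (λ a b → a + b + cycF n σ) valleys-τ fix-τ ⟩
      valleys n σ + (fixF n σ + 1) + cycF n σ        ≡⟨ regroup (valleys n σ) (fixF n σ) (cycF n σ) ⟩
      valleys n σ + fixF n σ + (cycF n σ + 1) + 0    ≡⟨ cong (λ z → valleys n σ + fixF n σ + z + 0) (sym cy) ⟩
      valleys n σ + fixF n σ + cycF (suc n) τ + 0    ∎
      where
      open ≡-Reasoning
      regroup : ∀ a b d → a + (b + 1) + d ≡ a + b + (d + 1) + 0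
      regroup = solve-∀
    cv : cvalF (suc n) τ ≡ cvalF n σ
    cv = trans (cval-change 0 (cval+cyc≡valleys+fix P) (cval+cyc≡valleys+fix τ-isPerm) shift) (+-identityʳ _)

  statistics-at-fixed : c < n → σ c ≡ c → cvalF (suc n) τ ≡ cvalF n σ × cycF (suc n) τ ≡ cycF n σ × fixF (suc n) τ + 1 ≡ fixF n σ
  statistics-at-fixed c<n σc≡c = cv , cycF-τ-c<n c<n , fix-τ
    where
    open AtFixed c<n σc≡c
    shift : valleys (suc n) τ + fixF (suc n) τ + cycF n σ ≡ valleys n σ + fixF n σ + cycF (suc n) τ + 0
    shift = begin
      valleys (suc n) τ + fixF (suc n) τ + cycF n σ     ≡⟨ cong (λ a → a + fixF (suc n) τ + cycF n σ) valleys-τ ⟩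
      valleys n σ + 1 + fixF (suc n) τ + cycF n σ       ≡⟨ regroup (valleys n σ) (fixF (suc n) τ) (cycF n σ) ⟩
      valleys n σ + (fixF (suc n) τ + 1) + cycF n σ + 0 ≡⟨ cong₂ (λ a b → valleys n σ + a + b + 0) fix-τ (sym (cycF-τ-c<n c<n)) ⟩
      valleys n σ + fixF n σ + cycF (suc n) τ + 0       ∎
      where
      open ≡-Reasoning
      regroup : ∀ a b d → a + 1 + b + d ≡ a + (b + 1) + d + 0
      regroup = solve-∀
    cv : cvalF (suc n) τ ≡ cvalF n σ
    cv = trans (cval-change 0 (cval+cyc≡valleys+fix P) (cval+cyc≡valleys+fix τ-isPerm) shift) (+-identityʳ _)

  statistics-at-moved : c < n → σ c ≢ c →
    cvalF (suc n) τ ≡ cvalF n σ + valleyGain c × cycF (suc n) τ ≡ cycF n σ × fixF (suc n) τ ≡ fixF n σ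
  statistics-at-moved c<n σc≢c = cv , cycF-τ-c<n c<n , fix-τ
    where
    open AtMoved c<n σc≢c
    shift : valleys (suc n) τ + fixF (suc n) τ + cycF n σ ≡ valleys n σ + fixF n σ + cycF (suc n) τ + valleyGain c
    shift = begin
      valleys (suc n) τ + fixF (suc n) τ + cycF n σ        ≡⟨ cong₂ (λ a b → a + b + cycF n σ) valleys-τ fix-τ ⟩
      valleys n σ + valleyGain c + fixF n σ + cycF n σ     ≡⟨ regroup (valleys n σ) (valleyGain c) (fixF n σ) (cycF n σ) ⟩
      valleys n σ + fixF n σ + cycF n σ + valleyGain c     ≡⟨ cong (λ z → valleys n σ + fixF n σ + z + valleyGain c) (sym (cycF-τ-c<n c<n)) ⟩
      valleys n σ + fixF n σ + cycF (suc n) τ + valleyGain c ∎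
      where
      open ≡-Reasoning
      regroup : ∀ a g b d → a + g + b + d ≡ a + b + d + g
      regroup = solve-∀
    cv : cvalF (suc n) τ ≡ cvalF n σ + valleyGain c
    cv = cval-change (valleyGain c) (cval+cyc≡valleys+fix P) (cval+cyc≡valleys+fix τ-isPerm) shift

-- Counting moved points by the shape of (y, σ y, σ² y)

four-shapes : ∀ u v → 𝟙 (u ∧ v) + 𝟙 (not u ∧ not v) + 𝟙 (not u ∧ v) + 𝟙 (u ∧ not v) ≡ 1
four-shapes true  true  = refl
four-shapes true  false = refl
four-shapes false true  = refl
four-shapes false false = refl

𝟙-split-∧ʳ : ∀ b v x → (b ≡ true → x ≡ not v) → 𝟙 b ≡ 𝟙 (b ∧ v) + 𝟙 (b ∧ x)
𝟙-split-∧ʳ false v x _ = refl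
𝟙-split-∧ʳ true  v x h rewrite h refl with v
... | true  = refl
... | false = refl

𝟙-split-∧ˡ : ∀ u w x → (x ≡ true → w ≡ not u) → 𝟙 x ≡ 𝟙 (u ∧ x) + 𝟙 (w ∧ x)
𝟙-split-∧ˡ u     w false _ rewrite ∧-zeroʳ u | ∧-zeroʳ w = refl
𝟙-split-∧ˡ true  w true  h rewrite h refl = refl
𝟙-split-∧ˡ false w true  h rewrite h refl = refl

at-most-one : ∀ a u b → 𝟙 (a ∧ not u) + 𝟙 (u ∧ b) ≤ 1
at-most-one true  true  true  = ≤-refl
at-most-one true  true  false = z≤n
at-most-one true  false b     = ≤-refl
at-most-one false true  true  = ≤-refl
at-most-one false true  false = z≤n
at-most-one false false b     = z≤n

module ShapeCount {n σ} (P : IsPerm n σ) where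
  open IsPerm P
  open Inverse P

  σ-injective : ∀ {x y} → σ x ≡ σ y → x ≡ y
  σ-injective {x} {y} e with x <? n | y <? n
  ... | yes x<n | yes y<n = injective x<n y<n e
  ... | yes x<n | no  y≮n = ⊥-elim (y≮n (subst (_< n) (trans e (identity-beyond (≮⇒≥ y≮n))) (bounded x<n)))
  ... | no  x≮n | yes y<n = ⊥-elim (x≮n (subst (_< n) (trans (sym e) (identity-beyond (≮⇒≥ x≮n))) (bounded y<n)))
  ... | no  x≮n | no  y≮n = trans (sym (identity-beyond (≮⇒≥ x≮n))) (trans e (identity-beyond (≮⇒≥ y≮n)))

  ∑-reindex : ∀ (g : ℕ → ℕ) → ∑ n (g ∘ σ) ≡ ∑ n g
  ∑-reindex g = begin
      ∑ n (g ∘ σ)                 ≡⟨ sym (sum-map-upTo (g ∘ σ) n) ⟩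
      sum (map (g ∘ σ) (upTo n))  ≡⟨ cong sum (map-∘ (upTo n)) ⟩
      sum (map g (map σ (upTo n))) ≡⟨ sum-↭ (Perm.map⁺ g σ-permutes) ⟩
      sum (map g (upTo n))        ≡⟨ sum-map-upTo g n ⟩
      ∑ n g                       ∎
    where
    open ≡-Reasoning
    σ-permutes : map σ (upTo n) ↭ upTo n
    σ-permutes = unique-↭ (Unique.map⁺ σ-injective (Unique.upTo⁺ n)) (Unique.upTo⁺ n) to from
      where
      to : ∀ {x} → x ∈ map σ (upTo n) → x ∈ upTo n
      to x∈ with y , y∈ , refl ← ∈-map⁻ σ x∈ = ∈-upTo⁺ (bounded (∈-upTo⁻ y∈))
      from : ∀ {x} → x ∈ upTo n → x ∈ map σ (upTo n)
      from x∈ with y , y<n , refl ← surjective (∈-upTo⁻ x∈) = ∈-map⁺ σ (∈-upTo⁺ y<n)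

  moved doubleAscent doubleDescent peakAt descentAt : ℕ → ℕ
  moved         y = 𝟙 (not (σ y ≡ᵇ y))
  doubleAscent  y = 𝟙 ((y <ᵇ σ y) ∧ (σ y <ᵇ σ (σ y)))
  doubleDescent y = 𝟙 ((σ y <ᵇ y) ∧ (σ (σ y) <ᵇ σ y))
  peakAt        y = 𝟙 ((y <ᵇ σ y) ∧ (σ (σ y) <ᵇ σ y))
  descentAt     y = 𝟙 (σ y <ᵇ y)

  σ²y≢σy : ∀ {y} → y < n → σ y ≢ y → σ (σ y) ≢ σ y
  σ²y≢σy y<n σy≢y e = σy≢y (injective (bounded y<n) y<n e)

  moved-by-shape : ∀ y → y < n → moved y ≡ doubleAscent y + doubleDescent y + valleyAt σ y + peakAt y
  moved-by-shape y y<n with σ y ≟ y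
  ... | yes σy≡y rewrite ≡⇒≡ᵇ≡true σy≡y | ≮⇒<ᵇ≡false {y} {σ y} (<-irrefl (sym σy≡y)) | ≮⇒<ᵇ≡false {σ y} {y} (<-irrefl σy≡y) = refl
  ... | no  σy≢y rewrite ≢⇒≡ᵇ≡false σy≢y | <ᵇ-swap {y} {σ y} (σy≢y ∘ sym) | <ᵇ-swap {σ y} {σ (σ y)} (σ²y≢σy y<n σy≢y ∘ sym) =
        sym (four-shapes (y <ᵇ σ y) (σ y <ᵇ σ (σ y)))

  descent-at-y : ∀ y → y < n → descentAt y ≡ valleyAt σ y + doubleDescent y
  descent-at-y y y<n = 𝟙-split-∧ʳ (σ y <ᵇ y) (σ y <ᵇ σ (σ y)) (σ (σ y) <ᵇ σ y)
    (λ σy<y → <ᵇ-swap (σ²y≢σy y<n (λ σy≡y → <-irrefl σy≡y (<ᵇ≡true⇒< σy<y)) ∘ sym))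

  descent-at-σy : ∀ y → y < n → descentAt (σ y) ≡ peakAt y + doubleDescent y
  descent-at-σy y y<n = 𝟙-split-∧ˡ (y <ᵇ σ y) (σ y <ᵇ y) (σ (σ y) <ᵇ σ y)
    (λ σ²y<σy → <ᵇ-swap (λ y≡σy → <-irrefl (cong σ (sym y≡σy)) (<ᵇ≡true⇒< σ²y<σy)))

  ∑-valleys≡∑-peaks : valleys n σ ≡ ∑ n peakAt
  ∑-valleys≡∑-peaks = +-cancelʳ-≡ (∑ n doubleDescent) _ _ (begin
      ∑ n (valleyAt σ) + ∑ n doubleDescent         ≡⟨ sym (∑-+ n _ _) ⟩
      ∑ n (λ y → valleyAt σ y + doubleDescent y)   ≡⟨ sym (∑-cong n descent-at-y) ⟩
      ∑ n descentAt                                ≡⟨ sym (∑-reindex descentAt) ⟩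
      ∑ n (descentAt ∘ σ)                          ≡⟨ ∑-cong n descent-at-σy ⟩
      ∑ n (λ y → peakAt y + doubleDescent y)       ≡⟨ ∑-+ n _ _ ⟩
      ∑ n peakAt + ∑ n doubleDescent               ∎)
    where open ≡-Reasoning

  ∑-valleyGain : ∑ n valleyGain ≡ ∑ n doubleDescent + ∑ n doubleAscent
  ∑-valleyGain = begin
      ∑ n valleyGain                                ≡⟨ ∑-+ n gainˡ doubleAscent ⟩
      ∑ n gainˡ + ∑ n doubleAscent                  ≡⟨ cong (_+ ∑ n doubleAscent) (sym (∑-reindex gainˡ)) ⟩
      ∑ n (gainˡ ∘ σ) + ∑ n doubleAscent            ≡⟨ cong (_+ ∑ n doubleAscent) (∑-cong n gainˡ-at-σy) ⟩
      ∑ n doubleDescent + ∑ n doubleAscent          ∎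
    where
    open ≡-Reasoning
    gainˡ : ℕ → ℕ
    gainˡ c = 𝟙 ((c <ᵇ σ⁻¹ c) ∧ (σ c <ᵇ c))
    gainˡ-at-σy : ∀ y → y < n → gainˡ (σ y) ≡ doubleDescent y
    gainˡ-at-σy y y<n = cong (λ z → 𝟙 ((σ y <ᵇ z) ∧ (σ (σ y) <ᵇ σ y))) (σ⁻¹-inverseˡ y<n)

  ∑-moved : ∑ n moved ≡ ∑ n valleyGain + 2 * valleys n σ
  ∑-moved = begin
      ∑ n moved
    ≡⟨ ∑-cong n moved-by-shape ⟩
      ∑ n (λ y → doubleAscent y + doubleDescent y + valleyAt σ y + peakAt y)
    ≡⟨ trans (∑-+ n _ peakAt) (cong (_+ ∑ n peakAt) (trans (∑-+ n _ (valleyAt σ)) (cong (_+ valleys n σ) (∑-+ n doubleAscent doubleDescent)))) ⟩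
      ∑ n doubleAscent + ∑ n doubleDescent + valleys n σ + ∑ n peakAt
    ≡⟨ cong (∑ n doubleAscent + ∑ n doubleDescent + valleys n σ +_) (sym ∑-valleys≡∑-peaks) ⟩
      ∑ n doubleAscent + ∑ n doubleDescent + valleys n σ + valleys n σ
    ≡⟨ regroup (∑ n doubleAscent) (∑ n doubleDescent) (valleys n σ) ⟩
      ∑ n doubleDescent + ∑ n doubleAscent + 2 * valleys n σ
    ≡⟨ cong (_+ 2 * valleys n σ) (sym ∑-valleyGain) ⟩
      ∑ n valleyGain + 2 * valleys n σ
    ∎
    where
    open ≡-Reasoning
    regroup : ∀ a b v → a + b + v + v ≡ b + a + 2 * v
    regroup = solve-∀

  n≡fix+∑-valleyGain+2valleys : n ≡ fixF n σ + ∑ n valleyGain + 2 * valleys n σ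
  n≡fix+∑-valleyGain+2valleys = begin
      n                                                    ≡⟨ sym (∑-const-1 n) ⟩
      ∑ n (λ _ → 1)                                        ≡⟨ ∑-cong n (λ y _ → fixed-or-moved (σ y ≡ᵇ y)) ⟩
      ∑ n (λ y → 𝟙 (σ y ≡ᵇ y) + moved y)                   ≡⟨ ∑-+ n _ moved ⟩
      ∑ n (λ y → 𝟙 (σ y ≡ᵇ y)) + ∑ n moved                 ≡⟨ cong₂ _+_ (sym (fixF-≡-∑ n σ)) ∑-moved ⟩
      fixF n σ + (∑ n valleyGain + 2 * valleys n σ)        ≡⟨ sym (+-assoc (fixF n σ) _ _) ⟩
      fixF n σ + ∑ n valleyGain + 2 * valleys n σ          ∎
    where
    open ≡-Reasoning
    fixed-or-moved : ∀ b → 1 ≡ 𝟙 b + 𝟙 (not b)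
    fixed-or-moved true  = refl
    fixed-or-moved false = refl

  valleyGain-fixed : ∀ {c} → σ c ≡ c → valleyGain c ≡ 0
  valleyGain-fixed {c} σc≡c rewrite σc≡c | <ᵇ-irrefl c | ∧-zeroʳ (c <ᵇ σ⁻¹ c) = refl

  valleyGain≤1 : ∀ {c} → σ c ≢ c → valleyGain c ≤ 1
  valleyGain≤1 {c} σc≢c rewrite <ᵇ-swap {c} {σ c} (σc≢c ∘ sym) = at-most-one (c <ᵇ σ⁻¹ c) (c <ᵇ σ c) (σ c <ᵇ σ (σ c))

coeffAt : ℕ → ℕ → ℕ → ℕ → ℕ → ℕ → ℕ
coeffAt i j k a b d = 𝟙 ((a ≡ᵇ i) ∧ (b ≡ᵇ j) ∧ (d ≡ᵇ k))

coeffAfterInsertion : ℕ → ℕ → ℕ → ∀ n → (ℕ → ℕ) → ℕ → ℕ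
coeffAfterInsertion i j k n σ c = coeffAt i j k (cvalF (suc n) τ) (cycF (suc n) τ) (fixF (suc n) τ)
  where τ = insertAfter n σ c

module InsertionCount {n σ} (P : IsPerm n σ) (i j k : ℕ) where
  open Inverse P
  open ShapeCount P

  a b d : ℕ
  a = cvalF n σ
  b = cycF n σ
  d = fixF n σ

  inserted : ℕ → ℕ
  inserted = coeffAfterInsertion i j k n σ

  W X Y Z : ℕ
  W = coeffAt i j k a (suc b) (suc d)
  X = coeffAt i j (suc k) a b d
  Y = coeffAt i j k (suc a) b d
  Z = coeffAt i j k a b d

  coeffAt-cong : ∀ {x y z x′ y′ z′} → x ≡ x′ → y ≡ y′ → z ≡ z′ → coeffAt i j k x y z ≡ coeffAt i j k x′ y′ z′
  coeffAt-cong refl refl refl = refl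

  inserted-at-end : inserted n ≡ W
  inserted-at-end = let cv , cy , fx = InsertionStatistics.statistics-at-end P n ≤-refl refl in
    coeffAt-cong cv (trans cy (+-comm b 1)) (trans fx (+-comm d 1))

  inserted-at-fixed : ∀ c → c < n → σ c ≡ c → inserted c ≡ X
  inserted-at-fixed c c<n σc≡c = let cv , cy , fx = InsertionStatistics.statistics-at-fixed P c (<⇒≤ c<n) c<n σc≡c in
    trans (coeffAt-cong {z = fixF (suc n) (insertAfter n σ c)} cv cy refl) (cong (coeffAt i j (suc k) a b) (trans (+-comm 1 _) fx))

  inserted-at-moved : ∀ c → c < n → σ c ≢ c → inserted c + valleyGain c * Z ≡ valleyGain c * Y + Z
  inserted-at-moved c c<n σc≢c = gain≤1 (valleyGain c) (valleyGain≤1 σc≢c) cv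
    where
    stats = InsertionStatistics.statistics-at-moved P c (<⇒≤ c<n) c<n σc≢c
    cv = proj₁ stats
    coeff-τ : ∀ {x} → cvalF (suc n) (insertAfter n σ c) ≡ x → inserted c ≡ coeffAt i j k x b d
    coeff-τ e = coeffAt-cong e (proj₁ (proj₂ stats)) (proj₂ (proj₂ stats))
    gain≤1 : ∀ g → g ≤ 1 → cvalF (suc n) (insertAfter n σ c) ≡ a + g → inserted c + g * Z ≡ g * Y + Z
    gain≤1 zero          _        e = trans (+-identityʳ _) (coeff-τ (trans e (+-identityʳ a)))
    gain≤1 (suc zero)    _        e = trans (cong₂ _+_ (coeff-τ (trans e (+-comm a 1))) (+-identityʳ Z))
                                            (cong (_+ Z) (sym (+-identityʳ Y)))
    gain≤1 (suc (suc _)) (s≤s ()) e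

  inserted-before-end : ∀ c → c < n → inserted c + valleyGain c * Z ≡ 𝟙 (σ c ≡ᵇ c) * X + valleyGain c * Y + moved c * Z
  inserted-before-end c c<n = by-fixedness (σ c ≟ c)
    where
    open ≡-Reasoning
    by-fixedness : Dec (σ c ≡ c) → inserted c + valleyGain c * Z ≡ 𝟙 (σ c ≡ᵇ c) * X + valleyGain c * Y + moved c * Z
    by-fixedness (yes σc≡c) = begin
        inserted c + valleyGain c * Z                          ≡⟨ cong₂ (λ x g → x + g * Z) (inserted-at-fixed c c<n σc≡c) (valleyGain-fixed σc≡c) ⟩
        X + 0                                                  ≡⟨ cong (_+ 0) (sym (trans (+-identityʳ _) (+-identityʳ X))) ⟩
        1 * X + 0 * Y + 0 * Z                                  ≡⟨ cong₂ (λ f g → 𝟙 f * X + g * Y + 𝟙 (not f) * Z) (sym (≡⇒≡ᵇ≡true σc≡c)) (sym (valleyGain-fixed σc≡c)) ⟩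
        𝟙 (σ c ≡ᵇ c) * X + valleyGain c * Y + moved c * Z      ∎
    by-fixedness (no σc≢c) = begin
        inserted c + valleyGain c * Z                          ≡⟨ inserted-at-moved c c<n σc≢c ⟩
        valleyGain c * Y + Z                                   ≡⟨ cong (valleyGain c * Y +_) (sym (+-identityʳ Z)) ⟩
        0 * X + valleyGain c * Y + 1 * Z                       ≡⟨ cong (λ f → 𝟙 f * X + valleyGain c * Y + 𝟙 (not f) * Z) (sym (≢⇒≡ᵇ≡false σc≢c)) ⟩
        𝟙 (σ c ≡ᵇ c) * X + valleyGain c * Y + moved c * Z      ∎

  ∑-inserted : ∑ (suc n) inserted ≡ W + d * X + ∑ n valleyGain * Y + 2 * valleys n σ * Z
  ∑-inserted = begin
      ∑ n inserted + inserted n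
    ≡⟨ cong₂ _+_ ∑-before-end inserted-at-end ⟩
      d * X + G * Y + 2 * valleys n σ * Z + W
    ≡⟨ regroup (d * X) (G * Y) (2 * valleys n σ * Z) W ⟩
      W + d * X + G * Y + 2 * valleys n σ * Z
    ∎
    where
    open ≡-Reasoning
    G = ∑ n valleyGain
    regroup : ∀ p q r s → p + q + r + s ≡ s + p + q + r
    regroup = solve-∀
    ∑-before-end : ∑ n inserted ≡ d * X + G * Y + 2 * valleys n σ * Z
    ∑-before-end = +-cancelʳ-≡ (G * Z) _ _ (begin
        ∑ n inserted + G * Z
      ≡⟨ cong (∑ n inserted +_) (sym (∑-*ʳ n valleyGain Z)) ⟩
        ∑ n inserted + ∑ n (λ c → valleyGain c * Z)
      ≡⟨ sym (∑-+ n _ _) ⟩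
        ∑ n (λ c → inserted c + valleyGain c * Z)
      ≡⟨ ∑-cong n inserted-before-end ⟩
        ∑ n (λ c → 𝟙 (σ c ≡ᵇ c) * X + valleyGain c * Y + moved c * Z)
      ≡⟨ trans (∑-+ n _ _) (cong (_+ ∑ n (λ c → moved c * Z)) (∑-+ n _ _)) ⟩
        ∑ n (λ c → 𝟙 (σ c ≡ᵇ c) * X) + ∑ n (λ c → valleyGain c * Y) + ∑ n (λ c → moved c * Z)
      ≡⟨ cong₂ _+_ (cong₂ _+_ (trans (∑-*ʳ n _ X) (cong (_* X) (sym (fixF-≡-∑ n σ)))) (∑-*ʳ n valleyGain Y))
                   (trans (∑-*ʳ n moved Z) (cong (_* Z) ∑-moved)) ⟩
        d * X + G * Y + (G + 2 * valleys n σ) * Z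
      ≡⟨ regroup′ (d * X) (G * Y) G (valleys n σ) Z ⟩
        d * X + G * Y + 2 * valleys n σ * Z + G * Z
      ∎)
      where
      regroup′ : ∀ p q g v z → p + q + (g + 2 * v) * z ≡ p + q + 2 * v * z + g * z
      regroup′ = solve-∀

𝟎 : Poly3
𝟎 _ _ _ = ℤ.+ 0

infix 4 _≗³_
_≗³_ : Poly3 → Poly3 → Set
P ≗³ Q = ∀ i j k → P i j k ≡ Q i j k

record Linear (F : Poly3 → Poly3) : Set where
  field
    cong³    : ∀ {P Q} → P ≗³ Q → F P ≗³ F Q
    additive : ∀ P Q → F (P ⊕ Q) ≗³ F P ⊕ F Q

  preserves-𝟎 : F 𝟎 ≗³ 𝟎
  preserves-𝟎 i j k = identityʳ-unique (F 𝟎 i j k) (F 𝟎 i j k) (sym (additive 𝟎 𝟎 i j k))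

open Linear

ℤ-interchange : ∀ (p q r s : ℤ) → (p ℤ.+ q) ℤ.+ (r ℤ.+ s) ≡ (p ℤ.+ r) ℤ.+ (q ℤ.+ s)
ℤ-interchange = ℤ-Solver.solve-∀

id-linear : Linear (λ P → P)
id-linear = record { cong³ = λ e → e ; additive = λ _ _ _ _ _ → refl }

⊕-linear : ∀ {F G} → Linear F → Linear G → Linear (λ P → F P ⊕ G P)
⊕-linear {F} {G} F-lin G-lin = record
  { cong³    = λ e i j k → cong₂ ℤ._+_ (cong³ F-lin e i j k) (cong³ G-lin e i j k)
  ; additive = λ P Q i j k → trans (cong₂ ℤ._+_ (additive F-lin P Q i j k) (additive G-lin P Q i j k))
                                     (ℤ-interchange (F P i j k) (F Q i j k) (G P i j k) (G Q i j k))
  }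

·-linear : ∀ c {F} → Linear F → Linear (λ P → c · F P)
·-linear c F-lin = record
  { cong³    = λ e i j k → cong (c ℤ.*_) (cong³ F-lin e i j k)
  ; additive = λ P Q i j k → trans (cong (c ℤ.*_) (additive F-lin P Q i j k)) (ℤ.*-distribˡ-+ c _ _)
  }

shiftDown-cong : ∀ a i z {f g : ℕ → ℤ} → (∀ x → f x ≡ g x) → shiftDown a i z f ≡ shiftDown a i z g
shiftDown-cong zero    i       z e = e i
shiftDown-cong (suc a) zero    z e = refl
shiftDown-cong (suc a) (suc i) z e = shiftDown-cong a i z e

shiftDown-+ : ∀ a i (f g : ℕ → ℤ) → shiftDown a i (ℤ.+ 0) (λ x → f x ℤ.+ g x) ≡ shiftDown a i (ℤ.+ 0) f ℤ.+ shiftDown a i (ℤ.+ 0) g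
shiftDown-+ zero    i       f g = refl
shiftDown-+ (suc a) zero    f g = refl
shiftDown-+ (suc a) (suc i) f g = shiftDown-+ a i f g

mono-linear : ∀ a b c {F} → Linear F → Linear (λ P → mono a b c (F P))
mono-linear a b c F-lin = record
  { cong³    = λ e i j k → shiftDown-cong a i _ (λ i′ → shiftDown-cong b j _ (λ j′ → shiftDown-cong c k _ (λ k′ →
                             cong³ F-lin e i′ j′ k′)))
  ; additive = λ P Q i j k → trans
      (shiftDown-cong a i _ (λ i′ → trans (shiftDown-cong b j _ (λ j′ → trans (shiftDown-cong c k _ (λ k′ →
         additive F-lin P Q i′ j′ k′)) (shiftDown-+ c k _ _))) (shiftDown-+ b j _ _)))
      (shiftDown-+ a i _ _)
  }

∂q-linear : Linear ∂q
∂q-linear = record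
  { cong³    = λ e i j k → cong (ℤ.+ suc i ℤ.*_) (e (suc i) j k)
  ; additive = λ P Q i j k → ℤ.*-distribˡ-+ (ℤ.+ suc i) (P (suc i) j k) (Q (suc i) j k)
  }

∂x-linear : Linear ∂x
∂x-linear = record
  { cong³    = λ e i j k → cong (ℤ.+ suc j ℤ.*_) (e i (suc j) k)
  ; additive = λ P Q i j k → ℤ.*-distribˡ-+ (ℤ.+ suc j) (P i (suc j) k) (Q i (suc j) k)
  }

∂y-linear : Linear ∂y
∂y-linear = record
  { cong³    = λ e i j k → cong (ℤ.+ suc k ℤ.*_) (e i j (suc k))
  ; additive = λ P Q i j k → ℤ.*-distribˡ-+ (ℤ.+ suc k) (P i j (suc k)) (Q i j (suc k))
  }

recRHS-linear : ∀ n → Linear (recRHS n)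
recRHS-linear n =
          ·-linear (ℤ.+ n) (mono-linear 1 0 0 id-linear)
  ⊕-l mono-linear 0 1 1 id-linear
  ⊕-l ·-linear (ℤ.+ 2) (mono-linear 1 0 0 ∂q-linear)
  ⊕-l ·-linear (ℤ.- ℤ.+ 2) (mono-linear 2 0 0 ∂q-linear)
  ⊕-l ·-linear (ℤ.+ 2) (mono-linear 0 1 0 ∂x-linear)
  ⊕-l ·-linear (ℤ.- ℤ.+ 2) (mono-linear 1 1 0 ∂x-linear)
  ⊕-l ∂y-linear
  ⊕-l ·-linear (ℤ.- ℤ.+ 2) (mono-linear 0 0 1 ∂y-linear)
  ⊕-l mono-linear 1 0 1 ∂y-linear
  where
  infixl 6 _⊕-l_
  _⊕-l_ : ∀ {F G} → Linear F → Linear G → Linear (λ P → F P ⊕ G P)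
  _⊕-l_ = ⊕-linear

∑ᴾ : List A → (A → Poly3) → Poly3
∑ᴾ []       G = 𝟎
∑ᴾ (x ∷ xs) G = G x ⊕ ∑ᴾ xs G

linear-∑ᴾ : ∀ {F} → Linear F → ∀ (xs : List A) G → F (∑ᴾ xs G) ≗³ ∑ᴾ xs (F ∘ G)
linear-∑ᴾ F-lin []       G = preserves-𝟎 F-lin
linear-∑ᴾ {F = F} F-lin (x ∷ xs) G i j k =
  trans (additive F-lin (G x) (∑ᴾ xs G) i j k) (cong (λ z → F (G x) i j k ℤ.+ z) (linear-∑ᴾ F-lin xs G i j k))

+sum≡∑ᴾ : ∀ (r : A → ℕ) (G : A → Poly3) xs i j k → (∀ {x} → x ∈ xs → ℤ.+ r x ≡ G x i j k) →
         ℤ.+ sum (map r xs) ≡ ∑ᴾ xs G i j k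
+sum≡∑ᴾ r G []       i j k e = refl
+sum≡∑ᴾ r G (x ∷ xs) i j k e = trans (ℤ.pos-+ (r x) _) (cong₂ ℤ._+_ (e (here refl)) (+sum≡∑ᴾ r G xs i j k (e ∘ there)))

monomial : ℕ → ℕ → ℕ → Poly3
monomial a b d i j k = ℤ.+ coeffAt i j k a b d

recRHS-by-terms : ∀ n P i j k t₁ t₂ t₃ t₄ t₅ t₆ t₇ t₈ t₉ →
  mono 1 0 0 P i j k ≡ t₁ → mono 0 1 1 P i j k ≡ t₂ → mono 1 0 0 (∂q P) i j k ≡ t₃ →
  mono 2 0 0 (∂q P) i j k ≡ t₄ → mono 0 1 0 (∂x P) i j k ≡ t₅ → mono 1 1 0 (∂x P) i j k ≡ t₆ →
  ∂y P i j k ≡ t₇ → mono 0 0 1 (∂y P) i j k ≡ t₈ → mono 1 0 1 (∂y P) i j k ≡ t₉ →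
  recRHS n P i j k ≡ ℤ.+ n ℤ.* t₁ ℤ.+ t₂ ℤ.+ ℤ.+ 2 ℤ.* t₃ ℤ.+ ℤ.- ℤ.+ 2 ℤ.* t₄ ℤ.+ ℤ.+ 2 ℤ.* t₅
                     ℤ.+ ℤ.- ℤ.+ 2 ℤ.* t₆ ℤ.+ t₇ ℤ.+ ℤ.- ℤ.+ 2 ℤ.* t₈ ℤ.+ t₉
recRHS-by-terms n P i j k _ _ _ _ _ _ _ _ _ refl refl refl refl refl refl refl refl refl = refl

∧-true⁻ : ∀ {x y} → (x ∧ y) ≡ true → x ≡ true × y ≡ true
∧-true⁻ {true} {true} _ = refl , refl

scale-𝟙 : ∀ m d b → (b ≡ true → m ≡ d) → ℤ.+ m ℤ.* ℤ.+ 𝟙 b ≡ ℤ.+ d ℤ.* ℤ.+ 𝟙 b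
scale-𝟙 m d false _ = trans (ℤ.*-zeroʳ (ℤ.+ m)) (sym (ℤ.*-zeroʳ (ℤ.+ d)))
scale-𝟙 m d true  h = cong (λ x → ℤ.+ x ℤ.* ℤ.+ 1) (h refl)

scale-at-zero₁ : ∀ d e → ℤ.+ 0 ≡ ℤ.+ d ℤ.* ℤ.+ 𝟙 ((d ≡ᵇ 0) ∧ e)
scale-at-zero₁ zero    e = refl
scale-at-zero₁ (suc d) e = sym (ℤ.*-zeroʳ (ℤ.+ suc d))

scale-at-zero₂ : ∀ c d e → ℤ.+ 0 ≡ ℤ.+ d ℤ.* ℤ.+ 𝟙 (c ∧ (d ≡ᵇ 0) ∧ e)
scale-at-zero₂ c zero    e = refl
scale-at-zero₂ c (suc d) e rewrite ∧-zeroʳ c = sym (ℤ.*-zeroʳ (ℤ.+ suc d))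

scale-at-zero₃ : ∀ c e d → ℤ.+ 0 ≡ ℤ.+ d ℤ.* ℤ.+ 𝟙 (c ∧ e ∧ (d ≡ᵇ 0))
scale-at-zero₃ c e zero    = refl
scale-at-zero₃ c e (suc d) rewrite ∧-zeroʳ e | ∧-zeroʳ c = sym (ℤ.*-zeroʳ (ℤ.+ suc d))

module _ (a b d : ℕ) where
  private
    M = monomial a b d

  coeff-q· : ∀ i j k → mono 1 0 0 M i j k ≡ ℤ.+ coeffAt i j k (suc a) b d
  coeff-q· zero    j k = refl
  coeff-q· (suc i) j k = refl

  coeff-xy· : ∀ i j k → mono 0 1 1 M i j k ≡ ℤ.+ coeffAt i j k a (suc b) (suc d)
  coeff-xy· i zero    k       = sym (cong (ℤ.+_ ∘ 𝟙) (∧-zeroʳ (a ≡ᵇ i)))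
  coeff-xy· i (suc j) zero    = sym (cong (ℤ.+_ ∘ 𝟙) (trans (cong ((a ≡ᵇ i) ∧_) (∧-zeroʳ (b ≡ᵇ j))) (∧-zeroʳ (a ≡ᵇ i))))
  coeff-xy· i (suc j) (suc k) = refl

  coeff-q∂q : ∀ i j k → mono 1 0 0 (∂q M) i j k ≡ ℤ.+ a ℤ.* ℤ.+ coeffAt i j k a b d
  coeff-q∂q zero    j k = scale-at-zero₁ a _
  coeff-q∂q (suc i) j k = scale-𝟙 (suc i) a _ (λ e → sym (≡ᵇ≡true⇒≡ (proj₁ (∧-true⁻ e))))

  coeff-q²∂q : ∀ i j k → mono 2 0 0 (∂q M) i j k ≡ ℤ.+ a ℤ.* ℤ.+ coeffAt i j k (suc a) b d
  coeff-q²∂q zero          j k = sym (ℤ.*-zeroʳ (ℤ.+ a))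
  coeff-q²∂q (suc zero)    j k = scale-at-zero₁ a _
  coeff-q²∂q (suc (suc i)) j k = scale-𝟙 (suc i) a _ (λ e → sym (≡ᵇ≡true⇒≡ (proj₁ (∧-true⁻ e))))

  coeff-x∂x : ∀ i j k → mono 0 1 0 (∂x M) i j k ≡ ℤ.+ b ℤ.* ℤ.+ coeffAt i j k a b d
  coeff-x∂x i zero    k = scale-at-zero₂ (a ≡ᵇ i) b _
  coeff-x∂x i (suc j) k = scale-𝟙 (suc j) b _ (λ e → sym (≡ᵇ≡true⇒≡ (proj₁ (∧-true⁻ (proj₂ (∧-true⁻ {a ≡ᵇ i} e))))))

  coeff-qx∂x : ∀ i j k → mono 1 1 0 (∂x M) i j k ≡ ℤ.+ b ℤ.* ℤ.+ coeffAt i j k (suc a) b d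
  coeff-qx∂x zero    j k = sym (ℤ.*-zeroʳ (ℤ.+ b))
  coeff-qx∂x (suc i) j k = coeff-x∂x i j k

  coeff-∂y : ∀ i j k → ∂y M i j k ≡ ℤ.+ d ℤ.* ℤ.+ coeffAt i j (suc k) a b d
  coeff-∂y i j k = scale-𝟙 (suc k) d _ (λ e → sym (≡ᵇ≡true⇒≡ (proj₂ (∧-true⁻ {b ≡ᵇ j} (proj₂ (∧-true⁻ {a ≡ᵇ i} e))))))

  coeff-y∂y : ∀ i j k → mono 0 0 1 (∂y M) i j k ≡ ℤ.+ d ℤ.* ℤ.+ coeffAt i j k a b d
  coeff-y∂y i j zero    = scale-at-zero₃ (a ≡ᵇ i) (b ≡ᵇ j) d
  coeff-y∂y i j (suc k) = coeff-∂y i j k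

  coeff-qy∂y : ∀ i j k → mono 1 0 1 (∂y M) i j k ≡ ℤ.+ d ℤ.* ℤ.+ coeffAt i j k (suc a) b d
  coeff-qy∂y zero    j k = sym (ℤ.*-zeroʳ (ℤ.+ d))
  coeff-qy∂y (suc i) j k = coeff-y∂y i j k

rhs-identity : ∀ (n a b d g v w x y z : ℤ) → n ≡ d ℤ.+ g ℤ.+ ℤ.+ 2 ℤ.* v → a ℤ.+ b ≡ v ℤ.+ d →
  n ℤ.* y ℤ.+ w ℤ.+ ℤ.+ 2 ℤ.* (a ℤ.* z) ℤ.+ ℤ.- ℤ.+ 2 ℤ.* (a ℤ.* y) ℤ.+ ℤ.+ 2 ℤ.* (b ℤ.* z)
    ℤ.+ ℤ.- ℤ.+ 2 ℤ.* (b ℤ.* y) ℤ.+ d ℤ.* x ℤ.+ ℤ.- ℤ.+ 2 ℤ.* (d ℤ.* z) ℤ.+ d ℤ.* y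
  ≡ w ℤ.+ d ℤ.* x ℤ.+ g ℤ.* y ℤ.+ ℤ.+ 2 ℤ.* v ℤ.* z
rhs-identity _ a b d g v w x y z refl a+b≡v+d =
  trans (expand a b d g v w x y z) (trans (cong (λ t → rest ℤ.+ ℤ.+ 2 ℤ.* (t ℤ.- (v ℤ.+ d)) ℤ.* (z ℤ.- y)) a+b≡v+d)
                                          (collapse d g v w x y z))
  where
  rest = w ℤ.+ d ℤ.* x ℤ.+ g ℤ.* y ℤ.+ ℤ.+ 2 ℤ.* v ℤ.* z
  expand : ∀ a b d g v w x y z →
    (d ℤ.+ g ℤ.+ ℤ.+ 2 ℤ.* v) ℤ.* y ℤ.+ w ℤ.+ ℤ.+ 2 ℤ.* (a ℤ.* z) ℤ.+ ℤ.- ℤ.+ 2 ℤ.* (a ℤ.* y) ℤ.+ ℤ.+ 2 ℤ.* (b ℤ.* z)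
      ℤ.+ ℤ.- ℤ.+ 2 ℤ.* (b ℤ.* y) ℤ.+ d ℤ.* x ℤ.+ ℤ.- ℤ.+ 2 ℤ.* (d ℤ.* z) ℤ.+ d ℤ.* y
    ≡ w ℤ.+ d ℤ.* x ℤ.+ g ℤ.* y ℤ.+ ℤ.+ 2 ℤ.* v ℤ.* z ℤ.+ ℤ.+ 2 ℤ.* (a ℤ.+ b ℤ.- (v ℤ.+ d)) ℤ.* (z ℤ.- y)
  expand = ℤ-Solver.solve-∀
  collapse : ∀ d g v w x y z →
    w ℤ.+ d ℤ.* x ℤ.+ g ℤ.* y ℤ.+ ℤ.+ 2 ℤ.* v ℤ.* z ℤ.+ ℤ.+ 2 ℤ.* (v ℤ.+ d ℤ.- (v ℤ.+ d)) ℤ.* (z ℤ.- y)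
    ≡ w ℤ.+ d ℤ.* x ℤ.+ g ℤ.* y ℤ.+ ℤ.+ 2 ℤ.* v ℤ.* z
  collapse = ℤ-Solver.solve-∀

∑-inserted≡recRHS-monomial : ∀ {n σ} (P : IsPerm n σ) i j k →
  ℤ.+ ∑ (suc n) (InsertionCount.inserted P i j k) ≡ recRHS n (monomial (cvalF n σ) (cycF n σ) (fixF n σ)) i j k
∑-inserted≡recRHS-monomial {n} {σ} P i j k = begin
    ℤ.+ ∑ (suc n) inserted
  ≡⟨ cong ℤ.+_ ∑-inserted ⟩
    ℤ.+ (W + d * X + G * Y + 2 * L * Z)
  ≡⟨ cast ⟩
    ℤ.+ W ℤ.+ ℤ.+ d ℤ.* ℤ.+ X ℤ.+ ℤ.+ G ℤ.* ℤ.+ Y ℤ.+ ℤ.+ 2 ℤ.* ℤ.+ L ℤ.* ℤ.+ Z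
  ≡⟨ sym (rhs-identity (ℤ.+ n) (ℤ.+ a) (ℤ.+ b) (ℤ.+ d) (ℤ.+ G) (ℤ.+ L) (ℤ.+ W) (ℤ.+ X) (ℤ.+ Y) (ℤ.+ Z) n-cast a+b-cast) ⟩
    _
  ≡⟨ sym (recRHS-by-terms n (monomial a b d) i j k _ _ _ _ _ _ _ _ _
            (coeff-q· a b d i j k) (coeff-xy· a b d i j k) (coeff-q∂q a b d i j k) (coeff-q²∂q a b d i j k)
            (coeff-x∂x a b d i j k) (coeff-qx∂x a b d i j k) (coeff-∂y a b d i j k) (coeff-y∂y a b d i j k)
            (coeff-qy∂y a b d i j k)) ⟩
    recRHS n (monomial a b d) i j k
  ∎
  where
  open ≡-Reasoning
  open InsertionCount P i j k
  open ShapeCount P using (n≡fix+∑-valleyGain+2valleys)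
  open Inverse P using (valleyGain)
  G = ∑ n valleyGain
  L = valleys n σ
  n-cast : ℤ.+ n ≡ ℤ.+ d ℤ.+ ℤ.+ G ℤ.+ ℤ.+ 2 ℤ.* ℤ.+ L
  n-cast = trans (cong ℤ.+_ n≡fix+∑-valleyGain+2valleys)
                 (trans (ℤ.pos-+ (d + G) (2 * L)) (cong₂ ℤ._+_ (ℤ.pos-+ d G) (ℤ.pos-* 2 L)))
  a+b-cast : ℤ.+ a ℤ.+ ℤ.+ b ≡ ℤ.+ L ℤ.+ ℤ.+ d
  a+b-cast = trans (sym (ℤ.pos-+ a b)) (trans (cong ℤ.+_ (ValleysOfPerm.cval+cyc≡valleys+fix P)) (ℤ.pos-+ L d))
  cast : ℤ.+ (W + d * X + G * Y + 2 * L * Z) ≡ ℤ.+ W ℤ.+ ℤ.+ d ℤ.* ℤ.+ X ℤ.+ ℤ.+ G ℤ.* ℤ.+ Y ℤ.+ ℤ.+ 2 ℤ.* ℤ.+ L ℤ.* ℤ.+ Z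
  cast = begin
      ℤ.+ (W + d * X + G * Y + 2 * L * Z)                         ≡⟨ ℤ.pos-+ (W + d * X + G * Y) (2 * L * Z) ⟩
      ℤ.+ (W + d * X + G * Y) ℤ.+ ℤ.+ (2 * L * Z)                 ≡⟨ cong₂ ℤ._+_ (ℤ.pos-+ (W + d * X) (G * Y)) (ℤ.pos-* (2 * L) Z) ⟩
      ℤ.+ (W + d * X) ℤ.+ ℤ.+ (G * Y) ℤ.+ ℤ.+ (2 * L) ℤ.* ℤ.+ Z   ≡⟨ cong₂ (λ s t → s ℤ.+ ℤ.+ (G * Y) ℤ.+ t ℤ.* ℤ.+ Z)
                                                                          (ℤ.pos-+ W (d * X)) (ℤ.pos-* 2 L) ⟩
      ℤ.+ W ℤ.+ ℤ.+ (d * X) ℤ.+ ℤ.+ (G * Y) ℤ.+ ℤ.+ 2 ℤ.* ℤ.+ L ℤ.* ℤ.+ Z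
                                                                  ≡⟨ cong₂ (λ s t → ℤ.+ W ℤ.+ s ℤ.+ t ℤ.+ ℤ.+ 2 ℤ.* ℤ.+ L ℤ.* ℤ.+ Z)
                                                                          (ℤ.pos-* d X) (ℤ.pos-* G Y) ⟩
      ℤ.+ W ℤ.+ ℤ.+ d ℤ.* ℤ.+ X ℤ.+ ℤ.+ G ℤ.* ℤ.+ Y ℤ.+ ℤ.+ 2 ℤ.* ℤ.+ L ℤ.* ℤ.+ Z ∎

lookupD-< : ∀ {N m} (v : Vec (Fin N) m) d {y} (y<m : y < m) → lookupD (map toℕ (toList v)) d y ≡ toℕ (lookup v (fromℕ< y<m))
lookupD-< (a ∷ v) d {zero}  (s≤s _)   = refl
lookupD-< (a ∷ v) d {suc y} (s≤s y<m) = lookupD-< v d y<m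

lookupD-≥ : ∀ xs d {y} → length xs ≤ y → lookupD xs d y ≡ d
lookupD-≥ []       d         _        = refl
lookupD-≥ (x ∷ xs) d {suc y} (s≤s le) = lookupD-≥ xs d le

length-oneLine : ∀ {N} (π : Perm N) → length (oneLine π) ≡ N
length-oneLine π = trans (length-map toℕ (toList π)) (Vec.length-toList π)

app-< : ∀ {N} (π : Perm N) {y} (y<N : y < N) → app π y ≡ toℕ (lookup π (fromℕ< y<N))
app-< π y<N = lookupD-< π _ y<N

app-≥ : ∀ {N} (π : Perm N) {y} → N ≤ y → app π y ≡ y
app-≥ π N≤y = lookupD-≥ (oneLine π) _ (subst (_≤ _) (sym (length-oneLine π)) N≤y)

app-lookup : ∀ {N} (π : Perm N) (i : Fin N) → app π (toℕ i) ≡ toℕ (lookup π i)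
app-lookup π i = trans (app-< π (toℕ<n i)) (cong (toℕ ∘ lookup π) (fromℕ<-toℕ i (toℕ<n i)))

app-bounded : ∀ {N} (π : Perm N) {y} → y < N → app π y < N
app-bounded π y<N = subst (_< _) (sym (app-< π y<N)) (toℕ<n _)

tabulatePerm : ∀ N (f : ℕ → ℕ) → (∀ y → y < N → f y < N) → Perm N
tabulatePerm N f bounded = tabulate (λ i → fromℕ< (bounded (toℕ i) (toℕ<n i)))

app-tabulatePerm : ∀ N f bounded {y} → y < N → app (tabulatePerm N f bounded) y ≡ f y
app-tabulatePerm N f bounded {y} y<N = begin
    app (tabulatePerm N f bounded) y                                ≡⟨ app-< (tabulatePerm N f bounded) y<N ⟩
    toℕ (lookup (tabulatePerm N f bounded) (fromℕ< y<N))            ≡⟨ cong toℕ (Vec.lookup∘tabulate _ (fromℕ< y<N)) ⟩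
    toℕ (fromℕ< (bounded (toℕ (fromℕ< y<N)) (toℕ<n (fromℕ< y<N))))  ≡⟨ toℕ-fromℕ< _ ⟩
    f (toℕ (fromℕ< y<N))                                            ≡⟨ cong f (toℕ-fromℕ< y<N) ⟩
    f y                                                             ∎
  where open ≡-Reasoning

app-injective : ∀ {N} {π π′ : Perm N} → (∀ y → y < N → app π y ≡ app π′ y) → π ≡ π′
app-injective {π = π} {π′} e = begin
    π                   ≡⟨ sym (Vec.tabulate∘lookup π) ⟩
    tabulate (lookup π)  ≡⟨ Vec.tabulate-cong (λ i → toℕ-injective (trans (sym (app-lookup π i))
                                                   (trans (e (toℕ i) (toℕ<n i)) (app-lookup π′ i)))) ⟩
    tabulate (lookup π′) ≡⟨ Vec.tabulate∘lookup π′ ⟩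
    π′                  ∎
  where open ≡-Reasoning

-- entries of a list, with junk value 0 beyond its end
nth : List ℕ → ℕ → ℕ
nth xs = lookupD xs 0

InjectiveList : List ℕ → Set
InjectiveList xs = ∀ y z → y < length xs → z < length xs → nth xs y ≡ nth xs z → y ≡ z

lookupD-default-irrelevant : ∀ xs d d′ {y} → y < length xs → lookupD xs d y ≡ lookupD xs d′ y
lookupD-default-irrelevant (x ∷ xs) d d′ {zero}  _        = refl
lookupD-default-irrelevant (x ∷ xs) d d′ {suc y} (s≤s lt) = lookupD-default-irrelevant xs d d′ lt

any-≡ᵇ-false⁻ : ∀ x xs → any (x ≡ᵇ_) xs ≡ false → ∀ z → z < length xs → nth xs z ≢ x
any-≡ᵇ-false⁻ x (w ∷ ws) e z z< with x ≡ᵇ w in x≟w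
any-≡ᵇ-false⁻ x (w ∷ ws) e zero    _        | false = ≡ᵇ≡false⇒≢ x≟w ∘ sym
any-≡ᵇ-false⁻ x (w ∷ ws) e (suc z) (s≤s lt) | false = any-≡ᵇ-false⁻ x ws e z lt

any-≡ᵇ-false⁺ : ∀ x xs → (∀ z → z < length xs → nth xs z ≢ x) → any (x ≡ᵇ_) xs ≡ false
any-≡ᵇ-false⁺ x []       h = refl
any-≡ᵇ-false⁺ x (w ∷ ws) h rewrite ≢⇒≡ᵇ≡false (h 0 z<s ∘ sym) = any-≡ᵇ-false⁺ x ws (λ z lt → h (suc z) (s≤s lt))

distinctᵇ⇒injective : ∀ xs → distinctᵇ xs ≡ true → InjectiveList xs
distinctᵇ⇒injective (x ∷ xs) e zero    zero    _         _         _  = refl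
distinctᵇ⇒injective (x ∷ xs) e zero    (suc z) _         (s≤s lt)  eq =
  ⊥-elim (any-≡ᵇ-false⁻ x xs (not-true⁻ (proj₁ (∧-true⁻ e))) z lt (sym eq))
  where
  not-true⁻ : ∀ {b} → not b ≡ true → b ≡ false
  not-true⁻ {false} _ = refl
distinctᵇ⇒injective (x ∷ xs) e (suc y) zero    (s≤s lt)  _         eq =
  ⊥-elim (any-≡ᵇ-false⁻ x xs (not-true⁻ (proj₁ (∧-true⁻ e))) y lt eq)
  where
  not-true⁻ : ∀ {b} → not b ≡ true → b ≡ false
  not-true⁻ {false} _ = refl
distinctᵇ⇒injective (x ∷ xs) e (suc y) (suc z) (s≤s l₁) (s≤s l₂) eq =
  cong suc (distinctᵇ⇒injective xs (proj₂ (∧-true⁻ e)) y z l₁ l₂ eq)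

injective⇒distinctᵇ : ∀ xs → InjectiveList xs → distinctᵇ xs ≡ true
injective⇒distinctᵇ []       h = refl
injective⇒distinctᵇ (x ∷ xs) h rewrite any-≡ᵇ-false⁺ x xs (λ z lt eq → 1+n≢0 (h (suc z) 0 (s≤s lt) z<s eq)) =
  injective⇒distinctᵇ xs (λ y z l₁ l₂ eq → suc-injective (h (suc y) (suc z) (s≤s l₁) (s≤s l₂) eq))

AppInjective : ∀ {N} → Perm N → Set
AppInjective {N} π = ∀ {y z} → y < N → z < N → app π y ≡ app π z → y ≡ z

nth-oneLine : ∀ {N} (π : Perm N) {y} → y < N → nth (oneLine π) y ≡ app π y
nth-oneLine π y<N = lookupD-default-irrelevant (oneLine π) 0 _ (subst (_ <_) (sym (length-oneLine π)) y<N)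

distinctᵇ⇒app-injective : ∀ {N} (π : Perm N) → distinctᵇ (oneLine π) ≡ true → AppInjective π
distinctᵇ⇒app-injective π e {y} {z} y< z< eq = distinctᵇ⇒injective (oneLine π) e y z
  (subst (_ <_) (sym (length-oneLine π)) y<) (subst (_ <_) (sym (length-oneLine π)) z<)
  (trans (nth-oneLine π y<) (trans eq (sym (nth-oneLine π z<))))

app-injective⇒distinctᵇ : ∀ {N} (π : Perm N) → AppInjective π → distinctᵇ (oneLine π) ≡ true
app-injective⇒distinctᵇ π h = injective⇒distinctᵇ (oneLine π) (λ y z l₁ l₂ eq →
  let y< = subst (y <_) (length-oneLine π) l₁
      z< = subst (z <_) (length-oneLine π) l₂
  in h y< z< (trans (sym (nth-oneLine π y<)) (trans eq (nth-oneLine π z<))))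

fin-injective⇒surjective : ∀ {N} (g : Fin N → Fin N) → (∀ {i j} → g i ≡ g j → i ≡ j) → ∀ x → ∃ λ i → g i ≡ x
fin-injective⇒surjective {suc N} g g-injective x with any? (λ i → g i ≟ᶠ x)
... | yes hit = hit
... | no  miss = ⊥-elim (1+n≰n (injective⇒≤ {f = h} h-injective))
  where
  h : Fin (suc N) → Fin N
  h i = punchOut {i = x} {j = g i} (λ e → miss (i , sym e))
  h-injective : ∀ {i j} → h i ≡ h j → i ≡ j
  h-injective {i} {j} eq = g-injective (punchOut-injective (λ e → miss (i , sym e)) (λ e → miss (j , sym e)) eq)

perm-isPerm : ∀ {N} (π : Perm N) → distinctᵇ (oneLine π) ≡ true → IsPerm N (app π)
perm-isPerm {N} π e = record
  { bounded = app-bounded π ; identity-beyond = app-≥ π ; injective = distinctᵇ⇒app-injective π e ; surjective = onto }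
  where
  lookup-injective : ∀ {i j} → lookup π i ≡ lookup π j → i ≡ j
  lookup-injective {i} {j} eq = toℕ-injective (distinctᵇ⇒app-injective π e (toℕ<n i) (toℕ<n j)
    (trans (app-lookup π i) (trans (cong toℕ eq) (sym (app-lookup π j)))))
  onto : ∀ {x} → x < N → ∃ λ y → y < N × app π y ≡ x
  onto {x} x<N = let i , πi≡x = fin-injective⇒surjective (lookup π) lookup-injective (fromℕ< x<N) in
    toℕ i , toℕ<n i , trans (app-lookup π i) (trans (cong toℕ πi≡x) (toℕ-fromℕ< x<N))

allVecs-complete : ∀ n m (v : Vec (Fin m) n) → v ∈ allVecs n m
allVecs-complete zero    m []      = here refl
allVecs-complete (suc n) m (a ∷ v) =
  ∈-concatMap-lose (λ w → map (_∷ w) (allFin m)) (allVecs-complete n m v) (∈-map⁺ (_∷ v) (∈-allFin a))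

allVecs-unique : ∀ n m → Unique (allVecs n m)
allVecs-unique zero    m = [] ∷ []
allVecs-unique (suc n) m = unique-concatMap (λ w → map (_∷ w) (allFin m)) (allVecs-unique n m)
  (λ _ → Unique.map⁺ Vec.∷-injectiveˡ (Unique.allFin⁺ m)) same-tail
  where
  same-tail : ∀ {w w′ v} → w ∈ allVecs n m → w′ ∈ allVecs n m → v ∈ map (_∷ w) (allFin m) → v ∈ map (_∷ w′) (allFin m) → w ≡ w′
  same-tail _ _ v∈ v∈′ with _ , _ , e ← ∈-map⁻ _ v∈ | _ , _ , e′ ← ∈-map⁻ _ v∈′ = Vec.∷-injectiveʳ (trans (sym e) e′)

∈-perms⁻ : ∀ {N} {π : Perm N} → π ∈ perms N → distinctᵇ (oneLine π) ≡ true
∈-perms⁻ {N} π∈ = proj₂ (∈-filterᵇ⁻ (λ v → distinctᵇ (oneLine v)) {xs = allVecs N N} π∈)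

∈-perms⁺ : ∀ {N} {π : Perm N} → distinctᵇ (oneLine π) ≡ true → π ∈ perms N
∈-perms⁺ {N} {π} e = ∈-filterᵇ⁺ (λ v → distinctᵇ (oneLine v)) (allVecs-complete N N π) e

perms-unique : ∀ N → Unique (perms N)
perms-unique N = unique-filterᵇ (λ v → distinctᵇ (oneLine v)) (allVecs-unique N N)

-- Every permutation of {0,…,n} arises from exactly one insertion

module Insertions (n : ℕ) where

  c≤n : (c : Fin (suc n)) → toℕ c ≤ n
  c≤n c = ≤-pred (toℕ<n c)

  insertAfter-bounded : ∀ (π : Perm n) c y → y < suc n → insertAfter n (app π) (toℕ c) y < suc n
  insertAfter-bounded π c y y< with insertView n (app π) (toℕ c) y
  ... | at-c _ e          rewrite e = ≤-refl
  ... | at-n refl n≢c e   rewrite e = m<n⇒m<1+n (app-bounded π (≤∧≢⇒< (c≤n c) (n≢c ∘ sym)))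
  ... | elsewhere _ y≢n e rewrite e = m<n⇒m<1+n (app-bounded π (≤∧≢⇒< (≤-pred y<) y≢n))

  insertV : Perm n → Fin (suc n) → Perm (suc n)
  insertV π c = tabulatePerm (suc n) (insertAfter n (app π) (toℕ c)) (insertAfter-bounded π c)

  app-insertV : ∀ π c y → app (insertV π c) y ≡ insertAfter n (app π) (toℕ c) y
  app-insertV π c y with y <? suc n
  ... | yes y< = app-tabulatePerm (suc n) _ (insertAfter-bounded π c) y<
  ... | no  y≮ = trans (app-≥ (insertV π c) (≮⇒≥ y≮))
      (sym (trans (insertAfter-other n (app π) (λ y≡c → y≮ (subst (_< suc n) (sym y≡c) (toℕ<n c)))
                                               (λ y≡n → y≮ (subst (_< suc n) (sym y≡n) ≤-refl)))
                  (app-≥ π (≤-trans (n≤1+n n) (≮⇒≥ y≮)))))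

  insertV-injective : ∀ {π π′ c c′} → insertV π c ≡ insertV π′ c′ → c ≡ c′ × π ≡ π′
  insertV-injective {π} {π′} {c} {c′} e = toℕ-injective same-c , app-injective same-σ
    where
    τ τ′ : ℕ → ℕ
    τ  = insertAfter n (app π) (toℕ c)
    τ′ = insertAfter n (app π′) (toℕ c′)
    same-τ : ∀ y → τ y ≡ τ′ y
    same-τ y = trans (sym (app-insertV π c y)) (trans (cong (λ v → app v y) e) (app-insertV π′ c′ y))
    -- τ′ (toℕ c) ≡ τ (toℕ c) ≡ n, while n is the image of toℕ c′ only
    same-c : toℕ c ≡ toℕ c′
    same-c with toℕ c ≟ toℕ c′
    ... | yes e′ = e′
    ... | no  c≢c′ with toℕ c ≟ n
    ...   | yes c≡n = ⊥-elim (<⇒≢ (app-bounded π′ (≤∧≢⇒< (c≤n c′) (λ c′≡n → c≢c′ (trans c≡n (sym c′≡n)))))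
              (trans (sym (insertAfter-n n (app π′) (λ c′≡n → c≢c′ (trans c≡n (sym c′≡n)))))
                     (trans (cong τ′ (sym c≡n)) (trans (sym (same-τ (toℕ c))) (insertAfter-c n (app π) (toℕ c))))))
    ...   | no  c≢n = ⊥-elim (<⇒≢ (app-bounded π′ (≤∧≢⇒< (c≤n c) c≢n))
              (trans (sym (insertAfter-other n (app π′) c≢c′ c≢n))
                     (trans (sym (same-τ (toℕ c))) (insertAfter-c n (app π) (toℕ c)))))
    same-σ : ∀ y → y < n → app π y ≡ app π′ y
    same-σ y y<n with y ≟ toℕ c
    ... | yes refl = trans (sym (insertAfter-n n (app π) (<⇒≢ y<n)))
                       (trans (same-τ n) (trans (cong (λ z → insertAfter n (app π′) z n) (sym same-c))
                                                (insertAfter-n n (app π′) (<⇒≢ y<n))))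
    ... | no  y≢c  = trans (sym (insertAfter-other n (app π) y≢c (<⇒≢ y<n)))
                       (trans (same-τ y) (insertAfter-other n (app π′) (λ y≡c′ → y≢c (trans y≡c′ (sym same-c))) (<⇒≢ y<n)))

  insertions : List (Perm (suc n))
  insertions = concatMap (λ π → map (insertV π) (allFin (suc n))) (perms n)

  insertions-unique : Unique insertions
  insertions-unique = unique-concatMap (λ π → map (insertV π) (allFin (suc n))) (perms-unique n)
    (λ {π} _ → Unique.map⁺ (λ {c} {c′} e → proj₁ (insertV-injective {π} {π} {c} {c′} e)) (Unique.allFin⁺ (suc n)))
    same-π
    where
    same-π : ∀ {π π′ v} → π ∈ perms n → π′ ∈ perms n →
             v ∈ map (insertV π) (allFin (suc n)) → v ∈ map (insertV π′) (allFin (suc n)) → π ≡ π′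
    same-π {π} {π′} _ _ v∈ v∈′ with c , _ , e ← ∈-map⁻ (insertV π) {xs = allFin (suc n)} v∈ | c′ , _ , e′ ← ∈-map⁻ (insertV π′) {xs = allFin (suc n)} v∈′ =
      proj₂ (insertV-injective {π} {π′} {c} {c′} (trans (sym e) e′))

  insertV-∈-perms : ∀ {π} c → π ∈ perms n → insertV π c ∈ perms (suc n)
  insertV-∈-perms {π} c π∈ = ∈-perms⁺ (app-injective⇒distinctᵇ (insertV π c) (λ {y} {z} y< z< e →
      IsPerm.injective τ-isPerm y< z< (trans (sym (app-insertV π c y)) (trans e (app-insertV π c z)))))
    where open Insertion (perm-isPerm π (∈-perms⁻ π∈)) (toℕ c) (c≤n c) using (τ-isPerm)

  -- σ is τ with n cut out of its cycle: σ (τ⁻¹ n) = τ n.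
  decompose : ∀ {τ} → τ ∈ perms (suc n) → ∃ λ (π : Perm n) → ∃ λ (c : Fin (suc n)) → π ∈ perms n × insertV π c ≡ τ
  decompose {τ} τ∈ = π , fromℕ< c<1+n , ∈-perms⁺ (app-injective⇒distinctᵇ π π-injective) , app-injective agree
    where
    open IsPerm (perm-isPerm τ (∈-perms⁻ τ∈))
    preimage-of-n = surjective (≤-refl {suc n})
    c = proj₁ preimage-of-n
    c<1+n = proj₁ (proj₂ preimage-of-n)
    τc≡n = proj₂ (proj₂ preimage-of-n)
    σ : ℕ → ℕ
    σ y = if y ≡ᵇ c then app τ n else app τ y
    σ-c : σ c ≡ app τ n
    σ-c = cong (if_then app τ n else app τ c) (≡⇒≡ᵇ≡true {c} refl)
    σ-other : ∀ {y} → y ≢ c → σ y ≡ app τ y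
    σ-other {y} y≢c = cong (if_then app τ n else app τ y) (≢⇒≡ᵇ≡false y≢c)
    τ≢n : ∀ {y} → y < suc n → y ≢ c → app τ y ≢ n
    τ≢n y< y≢c e = y≢c (injective y< c<1+n (trans e (sym τc≡n)))
    σ-bounded : ∀ y → y < n → σ y < n
    σ-bounded y y<n with y ≟ c
    ... | yes refl = subst (_< n) (sym σ-c) (≤∧≢⇒< (≤-pred (bounded ≤-refl)) (τ≢n ≤-refl (<⇒≢ y<n ∘ sym)))
    ... | no  y≢c  = subst (_< n) (sym (σ-other y≢c)) (≤∧≢⇒< (≤-pred (bounded (m<n⇒m<1+n y<n))) (τ≢n (m<n⇒m<1+n y<n) y≢c))
    π : Perm n
    π = tabulatePerm n σ σ-bounded
    app-π : ∀ {y} → y < n → app π y ≡ σ y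
    app-π = app-tabulatePerm n σ σ-bounded
    σ-injective : ∀ {y z} → y < n → z < n → σ y ≡ σ z → y ≡ z
    σ-injective {y} {z} y< z< e with y ≟ c | z ≟ c
    ... | yes y≡c | yes z≡c = trans y≡c (sym z≡c)
    ... | yes y≡c | no  z≢c = ⊥-elim (<⇒≢ z< (sym (injective ≤-refl (m<n⇒m<1+n z<)
                                  (trans (sym σ-c) (trans (cong σ (sym y≡c)) (trans e (σ-other z≢c)))))))
    ... | no  y≢c | yes z≡c = ⊥-elim (<⇒≢ y< (sym (injective ≤-refl (m<n⇒m<1+n y<)
                                  (trans (sym σ-c) (trans (cong σ (sym z≡c)) (trans (sym e) (σ-other y≢c)))))))
    ... | no  y≢c | no  z≢c = injective (m<n⇒m<1+n y<) (m<n⇒m<1+n z<) (trans (sym (σ-other y≢c)) (trans e (σ-other z≢c)))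
    π-injective : AppInjective π
    π-injective y< z< e = σ-injective y< z< (trans (sym (app-π y<)) (trans e (app-π z<)))
    agree : ∀ y → y < suc n → app (insertV π (fromℕ< c<1+n)) y ≡ app τ y
    agree y y< = trans (app-insertV π (fromℕ< c<1+n) y) (trans (cong (λ z → insertAfter n (app π) z y) (toℕ-fromℕ< c<1+n)) by-view)
      where
      by-view : insertAfter n (app π) c y ≡ app τ y
      by-view with insertView n (app π) c y
      ... | at-c y≡c e        = trans e (sym (trans (cong (app τ) y≡c) τc≡n))
      ... | at-n y≡n y≢c e    = trans e (trans (app-π (≤∧≢⇒< (≤-pred c<1+n) (λ c≡n → y≢c (trans y≡n (sym c≡n)))))
                                                (trans σ-c (cong (app τ) (sym y≡n))))
      ... | elsewhere y≢c y≢n e = trans e (trans (app-π (≤∧≢⇒< (≤-pred y<) y≢n)) (σ-other y≢c))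

  perms↭insertions : perms (suc n) ↭ insertions
  perms↭insertions = unique-↭ (perms-unique (suc n)) insertions-unique to from
    where
    to : ∀ {τ} → τ ∈ perms (suc n) → τ ∈ insertions
    to τ∈ = let π , c , π∈ , e = decompose τ∈ in
      subst (_∈ insertions) e (∈-concatMap-lose (λ π → map (insertV π) (allFin (suc n))) {xs = perms n} π∈ (∈-map⁺ (insertV π) (∈-allFin c)))
    from : ∀ {τ} → τ ∈ insertions → τ ∈ perms (suc n)
    from τ∈ = let π , π∈ , τ∈π = ∈-concatMap-find (λ π → map (insertV π) (allFin (suc n))) (perms n) τ∈
                  c , _ , e = ∈-map⁻ (insertV π) {xs = allFin (suc n)} τ∈π
              in subst (_∈ perms (suc n)) (sym e) (insertV-∈-perms c π∈)

orbitGo-cong : ∀ {f g : ℕ → ℕ} → (∀ y → f y ≡ g y) → ∀ s k x → orbitGo f s k x ≡ orbitGo g s k x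
orbitGo-cong     f≗g s zero    x = refl
orbitGo-cong {g = g} f≗g s (suc k) x =
  cong (λ r → if x ≡ᵇ s then [] else x ∷ r) (trans (orbitGo-cong f≗g s k _) (cong (orbitGo g s k) (f≗g x)))

filterᵇ-cong : ∀ {p q : A → Bool} → (∀ x → p x ≡ q x) → ∀ xs → filterᵇ p xs ≡ filterᵇ q xs
filterᵇ-cong         p≗q []       = refl
filterᵇ-cong {p = p} {q} p≗q (x ∷ xs) with p x | q x | p≗q x
... | true  | .true  | refl = cong (x ∷_) (filterᵇ-cong p≗q xs)
... | false | .false | refl = filterᵇ-cong p≗q xs

statistics-cong : ∀ N {f g : ℕ → ℕ} → (∀ y → f y ≡ g y) →
                  cvalF N f ≡ cvalF N g × cycF N f ≡ cycF N g × fixF N f ≡ fixF N g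
statistics-cong N {f} {g} f≗g =
  trans (cong (λ ms → sum (map cvalCycle (map (cycleF N f) ms))) same-mins) (cong (sum ∘ map cvalCycle) (map-cong same-cycle (cycleMins N g))) ,
  trans (cong (λ ms → length (map (cycleF N f) ms)) same-mins) (cong length (map-cong same-cycle (cycleMins N g))) ,
  cong length (filterᵇ-cong (λ y → cong (_≡ᵇ y) (f≗g y)) (upTo N))
  where
  same-cycle : ∀ i → cycleF N f i ≡ cycleF N g i
  same-cycle i = cong (i ∷_) (trans (orbitGo-cong f≗g i N (f i)) (cong (orbitGo g i N) (f≗g i)))
  same-mins : cycleMins N f ≡ cycleMins N g
  same-mins = filterᵇ-cong (λ i → cong (all (i ≤ᵇ_)) (same-cycle i)) (upTo N)

tabulate-∘toℕ : ∀ m (G : ℕ → ℕ) → List.tabulate {n = m} (G ∘ toℕ) ≡ applyUpTo G m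
tabulate-∘toℕ zero    G = refl
tabulate-∘toℕ (suc m) G = cong (G 0 ∷_) (tabulate-∘toℕ m (G ∘ suc))

sum-map-allFin : ∀ m (G : ℕ → ℕ) → sum (map (G ∘ toℕ) (allFin m)) ≡ ∑ m G
sum-map-allFin m G = begin
    sum (map (G ∘ toℕ) (allFin m))    ≡⟨ cong sum (map-tabulate {n = m} (λ c → c) (G ∘ toℕ)) ⟩
    sum (List.tabulate {n = m} (G ∘ toℕ)) ≡⟨ cong sum (tabulate-∘toℕ m G) ⟩
    sum (applyUpTo G m)               ≡⟨ cong sum (sym (map-upTo G m)) ⟩
    sum (map G (upTo m))              ≡⟨ sum-map-upTo G m ⟩
    ∑ m G                             ∎
  where open ≡-Reasoning

coeffOf : ∀ {N} → ℕ → ℕ → ℕ → Perm N → ℕ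
coeffOf i j k π = coeffAt i j k (cval π) (cyc π) (fix π)

V-≡-sum : ∀ N i j k → V N i j k ≡ ℤ.+ sum (map (coeffOf i j k) (perms N))
V-≡-sum N i j k = cong ℤ.+_ (length-filterᵇ _ (perms N))

V-≗-∑ᴾ : ∀ N → V N ≗³ ∑ᴾ (perms N) (λ π → monomial (cval π) (cyc π) (fix π))
V-≗-∑ᴾ N i j k = trans (V-≡-sum N i j k) (+sum≡∑ᴾ (coeffOf i j k) _ (perms N) i j k (λ _ → refl))

sum-over-insertions : ∀ n i j k →
  sum (map (coeffOf i j k) (perms (suc n))) ≡ sum (map (λ π → ∑ (suc n) (coeffAfterInsertion i j k n (app π))) (perms n))
sum-over-insertions n i j k = begin
    sum (map (coeffOf i j k) (perms (suc n)))
  ≡⟨ sum-↭ (Perm.map⁺ (coeffOf i j k) perms↭insertions) ⟩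
    sum (map (coeffOf i j k) insertions)
  ≡⟨ sum-map-concatMap (coeffOf i j k) (λ π → map (insertV π) (allFin (suc n))) (perms n) ⟩
    sum (map (λ π → sum (map (coeffOf i j k) (map (insertV π) (allFin (suc n))))) (perms n))
  ≡⟨ cong sum (map-cong per-perm (perms n)) ⟩
    sum (map (λ π → ∑ (suc n) (coeffAfterInsertion i j k n (app π))) (perms n))
  ∎
  where
  open ≡-Reasoning
  open Insertions n
  per-place : ∀ π c → coeffOf i j k (insertV π c) ≡ coeffAfterInsertion i j k n (app π) (toℕ c)
  per-place π c = let cv , cy , fx = statistics-cong (suc n) (app-insertV π c) in cong₃ cv cy fx
    where
    cong₃ : ∀ {x y z x′ y′ z′} → x ≡ x′ → y ≡ y′ → z ≡ z′ → coeffAt i j k x y z ≡ coeffAt i j k x′ y′ z′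
    cong₃ refl refl refl = refl
  per-perm : ∀ π → sum (map (coeffOf i j k) (map (insertV π) (allFin (suc n)))) ≡ ∑ (suc n) (coeffAfterInsertion i j k n (app π))
  per-perm π = begin
      sum (map (coeffOf i j k) (map (insertV π) (allFin (suc n))))                  ≡⟨ cong sum (sym (map-∘ (allFin (suc n)))) ⟩
      sum (map (coeffOf i j k ∘ insertV π) (allFin (suc n)))                        ≡⟨ cong sum (map-cong (per-place π) (allFin (suc n))) ⟩
      sum (map (coeffAfterInsertion i j k n (app π) ∘ toℕ) (allFin (suc n)))        ≡⟨ sum-map-allFin (suc n) _ ⟩
      ∑ (suc n) (coeffAfterInsertion i j k n (app π))                               ∎

mainTheorem5 : (n : ℕ) → 1 ≤ n → (i j k : ℕ) → V (suc n) i j k ≡ recRHS n (V n) i j k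
mainTheorem5 n _ i j k = begin
    V (suc n) i j k
  ≡⟨ V-≡-sum (suc n) i j k ⟩
    ℤ.+ sum (map (coeffOf i j k) (perms (suc n)))
  ≡⟨ cong ℤ.+_ (sum-over-insertions n i j k) ⟩
    ℤ.+ sum (map (λ π → ∑ (suc n) (coeffAfterInsertion i j k n (app π))) (perms n))
  ≡⟨ +sum≡∑ᴾ _ _ (perms n) i j k (λ {π} π∈ → ∑-inserted≡recRHS-monomial {n} {app π} (perm-isPerm π (∈-perms⁻ π∈)) i j k) ⟩
    ∑ᴾ (perms n) (λ π → recRHS n (monomial (cval π) (cyc π) (fix π))) i j k
  ≡⟨ sym (linear-∑ᴾ (recRHS-linear n) (perms n) _ i j k) ⟩
    recRHS n (∑ᴾ (perms n) (λ π → monomial (cval π) (cyc π) (fix π))) i j k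
  ≡⟨ sym (cong³ (recRHS-linear n) (V-≗-∑ᴾ n) i j k) ⟩
    recRHS n (V n) i j k
  ∎
  where open ≡-Reasoning
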